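{- Let $\pi\in S_n$ with pinnacles $y_1,\ldots,y_p$ and dells $v_1,\ldots,v_{p+1}$ (left-to-right order), $y_0=n+1$, $y_{p+1}=n+2$. Let $1\le i\le q\le p+1$ with $v_i\le v_q$, and suppose $u=\mathit{Next}_\pi(v_i)$ is not a pinnacle and satisfies $u<y_{q-1}$. Then there exist two reversals, the first balanced for $\pi$ and the second balanced for the result of the first, transforming $\pi$ into a permutation $\pi''$ such that the only differences between $\pi$ and $\pi''$ are the following: (i) if $u>v_q$, then $u$ is moved to the position immediately before $\mathit{cutD}_\pi(u,y_{q-1},v_q)$, so that $u\in D_{\pi''}(y_{q-1},v_q)$; (ii) if $u<v_q$, then $u$ is moved to the position immediately before $v_q$ and becomes the $q$-th dell $v''_q$ of $\pi''$.
   Context: Convention: a permutation $\pi=(\pi_1\,\ldots\,\pi_n)\in S_n$ is always extended by $\pi_0=n+1$ and $\pi_{n+1}=n+2$. For $1\le j\le n+1$, $\mathit{Prec}_\pi(\pi_j)=\pi_{j-1}$; for $0\le j\le n$, $\mathit{Next}_\pi(\pi_j)=\pi_{j+1}$. A pinnacle is an element $\pi_j$, $1\le j\le n$, with $\pi_{j-1}<\pi_j>\pi_{j+1}$; a dell is an element $\pi_j$, $1\le j\le n$, with $\pi_{j-1}>\pi_j<\pi_{j+1}$. If $\pi$ has $p$ pinnacles it has $p+1$ dells, and in left-to-right order they alternate as $v_1,y_1,v_2,y_2,\ldots,y_p,v_{p+1}$. For $1\le j\le p+1$, the ascending set $A_\pi(v_j,y_j)$ is the set of elements of the block of $\pi$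 with endpoints $v_j$ and $y_j$ that are neither dells nor pinnacles; for $0\le j\le p$, the descending set $D_\pi(y_j,v_{j+1})$ is defined likewise for the block with endpoints $y_j$ and $v_{j+1}$. For $0\le j\le p$ and an element $z\notin D_\pi(y_j,v_{j+1})$ with $v_{j+1}<z<y_j$, the cutpoint $\mathit{cutD}_\pi(z,y_j,v_{j+1})$ is the largest element $e\in D_\pi(y_j,v_{j+1})\cup\{v_{j+1}\}$ with $e<z$. For elements $w_1=\pi_a$, $w_2=\pi_b$ with $1\le a\le b\le n$, the reversal $\rho(w_1,w_2)$ transforms $\pi$ into $(\pi_0\ldots\pi_{a-1}\,\pi_b\,\pi_{b-1}\ldots\pi_a\,\pi_{b+1}\ldots\pi_{n+1})$; it is balanced for $\pi$ if it does not change the set of pinnacles. -}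

module Defs where

open import Data.Nat using (ℕ; zero; suc; _+_; _∸_; _<_; _≤_; _⊔_; _<?_; _≟_)
open import Data.Bool using (Bool; true; false; _∧_; if_then_else_)
open import Data.List using (List; []; _∷_; _++_; [_]; length; take; drop; reverse; filter; foldr)
open import Data.List.Membership.Propositional using (_∈_)
open import Data.Product using (_×_)
open import Relation.Nullary using (¬_)
open import Relation.Nullary.Decidable using (⌊_⌋; does)
open import Relation.Binary.PropositionalEquality using (_≡_)
open import Function.Bundles using (_⇔_)

-- A permutation π ∈ S_n is a list of the numbers 1..n (each exactly once).
-- Extension: π₀ = n+1, π_{n+1} = n+2.
ext : List ℕ → List ℕ
ext π = suc (length π) ∷ (π ++ [ suc (suc (length π)) ])

nth : List ℕ → ℕ → ℕ → ℕ
nth []       _       d = d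
nth (x ∷ xs) zero    d = x
nth (x ∷ xs) (suc k) d = nth xs k d

-- 0-based position of the first occurrence of x (length of list if absent)
indexOf : ℕ → List ℕ → ℕ
indexOf x []       = zero
indexOf x (y ∷ ys) = if does (x ≟ y) then zero else suc (indexOf x ys)

peaks : List ℕ → List ℕ
peaks (x ∷ rest@(y ∷ z ∷ r)) =
  if ⌊ x <? y ⌋ ∧ ⌊ z <? y ⌋ then y ∷ peaks rest else peaks rest
peaks _ = []

valleys : List ℕ → List ℕ
valleys (x ∷ rest@(y ∷ z ∷ r)) =
  if ⌊ y <? x ⌋ ∧ ⌊ y <? z ⌋ then y ∷ valleys rest else valleys rest
valleys _ = []

-- pinnacles / dells of π, left to right (the triples of the extended
-- permutation are centred exactly at π₁ … πₙ)
pinnacles : List ℕ → List ℕ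
pinnacles π = peaks (ext π)

dells : List ℕ → List ℕ
dells π = valleys (ext π)

-- y_j : y_0 = n+1, y_1 … y_p the pinnacles, y_{p+1} = n+2
pin : List ℕ → ℕ → ℕ
pin π zero    = suc (length π)
pin π (suc j) = nth (pinnacles π) j (suc (suc (length π)))

-- v_j (1 ≤ j ≤ p+1) : the j-th dell from the left
dell : List ℕ → ℕ → ℕ
dell π j = nth (dells π) (j ∸ 1) zero

next : List ℕ → ℕ → ℕ
next π x = nth (ext π) (suc (indexOf x (ext π))) zero

-- D_π(y_j, v_{j+1}) : entries of the extended permutation strictly between
-- the positions of y_j and v_{j+1}
Dset : List ℕ → ℕ → List ℕ
Dset π j = take (k₂ ∸ suc k₁) (drop (suc k₁) (ext π))
  where
  k₁ = indexOf (pin π j) (ext π)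
  k₂ = indexOf (dell π (suc j)) (ext π)

-- cutD_π(z, y_j, v_{j+1}) : largest e ∈ D_π(y_j,v_{j+1}) ∪ {v_{j+1}} with e < z
cutD : List ℕ → ℕ → ℕ → ℕ
cutD π z j = foldr _⊔_ zero (filter (λ e → e <? z) (dell π (suc j) ∷ Dset π j))

-- reversal ρ(w₁,w₂) : π = π₁…πₙ with w₁ = π_a, w₂ = π_b (a ≤ b)
-- ↦ π₁…π_{a-1} π_b π_{b-1} … π_a π_{b+1} … πₙ
ρ : ℕ → ℕ → List ℕ → List ℕ
ρ w₁ w₂ π = take a π ++ reverse (drop a (take (suc b) π)) ++ drop (suc b) π
  where
  a = indexOf w₁ π
  b = indexOf w₂ π

ValidRev : List ℕ → ℕ → ℕ → Set
ValidRev π w₁ w₂ = w₁ ∈ π × w₂ ∈ π × indexOf w₁ π ≤ indexOf w₂ π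

Balanced : List ℕ → ℕ → ℕ → Set
Balanced π w₁ w₂ = ∀ x → (x ∈ pinnacles π) ⇔ (x ∈ pinnacles (ρ w₁ w₂ π))

insertBefore : ℕ → ℕ → List ℕ → List ℕ
insertBefore u t []       = []
insertBefore u t (x ∷ xs) =
  if does (x ≟ t) then u ∷ x ∷ xs else x ∷ insertBefore u t xs

moveBefore : ℕ → ℕ → List ℕ → List ℕ
moveBefore u t π = insertBefore u t (filter (λ x → ¬? (x ≟ u)) π)
  where open import Relation.Nullary.Decidable using (¬?)

-- Write u = Next(v_i). Moving u across a block K of consecutive entries is the composite of
-- two reversals: reverse K together with u, then reverse K alone. For i = q the block runs
-- from the cut point c = cutD(u, y_{q-1}, v_q) to v_q, and u moves left in front of c; for
-- i < q it runs from the entry after u to the last entry d > u of the descent from y_{q-1},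
-- and u moves right in front of the entry c following d (the cut point if v_q < u, and v_q
-- itself otherwise). The hypotheses (u is not a pinnacle, u < y_{q-1}) make every triple
-- meeting an end of the block a non-peak at all three stages, so the first reversal merely
-- reverses the order of the pinnacles inside the block and the second restores it: both are
-- balanced. The same local analysis of the valleys shows that the dells do not change,
-- except that u replaces v_q when u < v_q.

module Submission where

open import Defs
open import Data.Bool using (Bool; true; false; _∧_; if_then_else_)
open import Data.Bool.Properties using (∧-comm; ∧-zeroʳ)
open import Data.Empty using (⊥; ⊥-elim)
open import Data.List using (List; []; _∷_; _++_; length; take; drop; reverse; filter; foldr; map; upTo)
import Data.List.Reverse as Reverse
open Reverse using (reverseView; _∶_∶ʳ_)
open import Data.List.Membership.Propositional using (_∈_; _∉_)
open import Data.List.Membership.Propositional.Properties using (∈-++⁺ˡ; ∈-++⁺ʳ; ∈-++⁻; ∈-map⁻; ∈-upTo⁻; ∈-filter⁻)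
open import Data.List.Properties using (∷-injective; ∷-injectiveˡ; ++-assoc; reverse-++; unfold-reverse; ++-identityʳ; reverse-involutive; length-++; length-reverse; length-map; length-upTo; ∷ʳ-injective; filter-accept; filter-reject)
open import Data.List.Relation.Binary.Permutation.Propositional using (_↭_; ↭-sym; prep; swap)
import Data.List.Relation.Binary.Permutation.Propositional as Perm
open import Data.List.Relation.Binary.Permutation.Propositional.Properties using (∈-resp-↭; ++⁺ˡ; ++⁺ʳ; ↭-reverse; shift; ↭-length)
open import Data.List.Relation.Unary.All.Properties using (All¬⇒¬Any)
import Data.List.Relation.Unary.AllPairs as AllPairs
open import Data.List.Relation.Unary.Any using (here; there)
open import Data.List.Relation.Unary.Any.Properties using (reverse⁻)
open import Data.List.Relation.Unary.Unique.Propositional using (Unique)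
import Data.List.Relation.Unary.Unique.Propositional.Properties as UP
open import Data.Nat using (_≡ᵇ_; ℕ; zero; suc; _+_; _∸_; _<_; _≤_; _⊔_; _<?_; _≟_; z≤n; s≤s)
open import Data.Nat.Properties
open import Data.Product using (∃; ∃-syntax; _×_; _,_; proj₁; proj₂)
open import Data.Sum using (_⊎_; inj₁; inj₂; [_,_]′)
open import Data.Unit using (⊤; tt)
open import Function.Base using (_∘_)
open import Function.Bundles using (_⇔_; mk⇔)
open import Relation.Binary.Definitions using (Tri; tri<; tri≈; tri>)
open import Relation.Binary.PropositionalEquality
open import Relation.Nullary using (¬_; yes; no; Dec)
open import Relation.Nullary.Decidable using (⌊_⌋; ¬?)

-- Peaks and valleys as centres of triples

TriplePred : Set
TriplePred = ℕ → ℕ → ℕ → Bool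

centreIf : TriplePred → ℕ → ℕ → ℕ → List ℕ
centreIf f x y z = if f x y z then y ∷ [] else []

-- Unlike `peaks` and `valleys`, written with `++`, so that it can be cut at any position.
centres : TriplePred → List ℕ → List ℕ
centres f (x ∷ y ∷ z ∷ r) = centreIf f x y z ++ centres f (y ∷ z ∷ r)
centres f _ = []

isPeak : TriplePred
isPeak x y z = ⌊ x <? y ⌋ ∧ ⌊ z <? y ⌋

isValley : TriplePred
isValley x y z = ⌊ y <? x ⌋ ∧ ⌊ y <? z ⌋

peaks-∷ : ∀ x y z r → peaks (x ∷ y ∷ z ∷ r) ≡ centreIf isPeak x y z ++ peaks (y ∷ z ∷ r)
peaks-∷ x y z r with isPeak x y z
... | true = refl
... | false = refl

valleys-∷ : ∀ x y z r → valleys (x ∷ y ∷ z ∷ r) ≡ centreIf isValley x y z ++ valleys (y ∷ z ∷ r)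
valleys-∷ x y z r with isValley x y z
... | true = refl
... | false = refl

peaks≡centres : ∀ l → peaks l ≡ centres isPeak l
peaks≡centres (x ∷ y ∷ z ∷ r) = trans (peaks-∷ x y z r) (cong (centreIf isPeak x y z ++_) (peaks≡centres (y ∷ z ∷ r)))
peaks≡centres [] = refl
peaks≡centres (x ∷ []) = refl
peaks≡centres (x ∷ y ∷ []) = refl

valleys≡centres : ∀ l → valleys l ≡ centres isValley l
valleys≡centres (x ∷ y ∷ z ∷ r) = trans (valleys-∷ x y z r) (cong (centreIf isValley x y z ++_) (valleys≡centres (y ∷ z ∷ r)))
valleys≡centres [] = refl
valleys≡centres (x ∷ []) = refl
valleys≡centres (x ∷ y ∷ []) = refl

module _ {x y z : ℕ} (r : List ℕ) where

  peaks-∷-true : isPeak x y z ≡ true → peaks (x ∷ y ∷ z ∷ r) ≡ y ∷ peaks (y ∷ z ∷ r)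
  peaks-∷-true e = trans (peaks-∷ x y z r) (cong (λ b → (if b then y ∷ [] else []) ++ peaks (y ∷ z ∷ r)) e)

  peaks-∷-false : isPeak x y z ≡ false → peaks (x ∷ y ∷ z ∷ r) ≡ peaks (y ∷ z ∷ r)
  peaks-∷-false e = trans (peaks-∷ x y z r) (cong (λ b → (if b then y ∷ [] else []) ++ peaks (y ∷ z ∷ r)) e)

  valleys-∷-true : isValley x y z ≡ true → valleys (x ∷ y ∷ z ∷ r) ≡ y ∷ valleys (y ∷ z ∷ r)
  valleys-∷-true e = trans (valleys-∷ x y z r) (cong (λ b → (if b then y ∷ [] else []) ++ valleys (y ∷ z ∷ r)) e)

  valleys-∷-false : isValley x y z ≡ false → valleys (x ∷ y ∷ z ∷ r) ≡ valleys (y ∷ z ∷ r)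
  valleys-∷-false e = trans (valleys-∷ x y z r) (cong (λ b → (if b then y ∷ [] else []) ++ valleys (y ∷ z ∷ r)) e)

⌊<?⌋-true : ∀ {m n} → m < n → ⌊ m <? n ⌋ ≡ true
⌊<?⌋-true {m} {n} p with m <? n
... | yes _ = refl
... | no q = ⊥-elim (q p)

⌊<?⌋-false : ∀ {m n} → ¬ (m < n) → ⌊ m <? n ⌋ ≡ false
⌊<?⌋-false {m} {n} p with m <? n
... | yes q = ⊥-elim (p q)
... | no _ = refl

isPeak-true : ∀ {a b c} → a < b → c < b → isPeak a b c ≡ true
isPeak-true p q = cong₂ _∧_ (⌊<?⌋-true p) (⌊<?⌋-true q)

isPeak-falseˡ : ∀ {a b} c → ¬ a < b → isPeak a b c ≡ false
isPeak-falseˡ {a} {b} c n = cong (_∧ ⌊ c <? b ⌋) (⌊<?⌋-false n)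

isPeak-falseʳ : ∀ a {b c} → ¬ c < b → isPeak a b c ≡ false
isPeak-falseʳ a {b} {c} n = trans (cong (⌊ a <? b ⌋ ∧_) (⌊<?⌋-false n)) (∧-zeroʳ _)

isValley-true : ∀ {a b c} → b < a → b < c → isValley a b c ≡ true
isValley-true p q = cong₂ _∧_ (⌊<?⌋-true p) (⌊<?⌋-true q)

isValley-falseˡ : ∀ {a b} c → ¬ b < a → isValley a b c ≡ false
isValley-falseˡ {a} {b} c n = cong (_∧ ⌊ b <? c ⌋) (⌊<?⌋-false n)

isValley-falseʳ : ∀ a {b c} → ¬ b < c → isValley a b c ≡ false
isValley-falseʳ a {b} {c} n = trans (cong (⌊ b <? a ⌋ ∧_) (⌊<?⌋-false n)) (∧-zeroʳ _)

centres-++ : ∀ f L a b R → centres f (L ++ a ∷ b ∷ R) ≡ centres f (L ++ a ∷ b ∷ []) ++ centres f (a ∷ b ∷ R)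
centres-++ f [] a b R = refl
centres-++ f (x ∷ []) a b R with f x a b
... | true = refl
... | false = refl
centres-++ f (x ∷ y ∷ []) a b R rewrite centres-++ f (y ∷ []) a b R =
  sym (++-assoc (centreIf f x y a) (centres f (y ∷ a ∷ b ∷ [])) (centres f (a ∷ b ∷ R)))
centres-++ f (x ∷ y ∷ z ∷ L) a b R rewrite centres-++ f (y ∷ z ∷ L) a b R =
  sym (++-assoc (centreIf f x y z) (centres f (y ∷ z ∷ L ++ a ∷ b ∷ [])) (centres f (a ∷ b ∷ R)))

centres-∷ʳ : ∀ f L a b c → centres f (L ++ a ∷ b ∷ c ∷ []) ≡ centres f (L ++ a ∷ b ∷ []) ++ centreIf f a b c
centres-∷ʳ f L a b c rewrite centres-++ f L a b (c ∷ []) | ++-identityʳ (centreIf f a b c) = refl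

Reversible : TriplePred → Set
Reversible f = ∀ x y z → f x y z ≡ f z y x

isPeak-reversible : Reversible isPeak
isPeak-reversible x y z = ∧-comm ⌊ x <? y ⌋ ⌊ z <? y ⌋

reverse-centreIf : ∀ f x y z → reverse (centreIf f x y z) ≡ centreIf f x y z
reverse-centreIf f x y z with f x y z
... | true = refl
... | false = refl

reverse-∷-∷ : ∀ (y z : ℕ) r → reverse (y ∷ z ∷ r) ≡ reverse r ++ z ∷ y ∷ []
reverse-∷-∷ y z r = begin
    reverse (y ∷ z ∷ r)                  ≡⟨ unfold-reverse y (z ∷ r) ⟩
    reverse (z ∷ r) ++ y ∷ []            ≡⟨ cong (_++ y ∷ []) (unfold-reverse z r) ⟩
    (reverse r ++ z ∷ []) ++ y ∷ []      ≡⟨ ++-assoc (reverse r) (z ∷ []) (y ∷ []) ⟩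
    reverse r ++ z ∷ y ∷ []              ∎
  where open ≡-Reasoning

reverse-∷-∷-∷ : ∀ (x y z : ℕ) r → reverse (x ∷ y ∷ z ∷ r) ≡ reverse r ++ z ∷ y ∷ x ∷ []
reverse-∷-∷-∷ x y z r = begin
    reverse (x ∷ y ∷ z ∷ r)              ≡⟨ unfold-reverse x (y ∷ z ∷ r) ⟩
    reverse (y ∷ z ∷ r) ++ x ∷ []        ≡⟨ cong (_++ x ∷ []) (reverse-∷-∷ y z r) ⟩
    (reverse r ++ z ∷ y ∷ []) ++ x ∷ []  ≡⟨ ++-assoc (reverse r) (z ∷ y ∷ []) (x ∷ []) ⟩
    reverse r ++ z ∷ y ∷ x ∷ []          ∎
  where open ≡-Reasoning

centres-reverse : ∀ f → Reversible f → ∀ l → centres f (reverse l) ≡ reverse (centres f l)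
centres-reverse f s [] = refl
centres-reverse f s (x ∷ []) = refl
centres-reverse f s (x ∷ y ∷ []) = refl
centres-reverse f s (x ∷ y ∷ z ∷ r) = begin
    centres f (reverse (x ∷ y ∷ z ∷ r))
  ≡⟨ cong (centres f) (reverse-∷-∷-∷ x y z r) ⟩
    centres f (reverse r ++ z ∷ y ∷ x ∷ [])
  ≡⟨ centres-∷ʳ f (reverse r) z y x ⟩
    centres f (reverse r ++ z ∷ y ∷ []) ++ centreIf f z y x
  ≡⟨ cong₂ _++_ (cong (centres f) (sym (reverse-∷-∷ y z r))) (cong (λ b → if b then y ∷ [] else []) (s z y x)) ⟩
    centres f (reverse (y ∷ z ∷ r)) ++ centreIf f x y z
  ≡⟨ cong₂ _++_ (centres-reverse f s (y ∷ z ∷ r)) (sym (reverse-centreIf f x y z)) ⟩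
    reverse (centres f (y ∷ z ∷ r)) ++ reverse (centreIf f x y z)
  ≡⟨ sym (reverse-++ (centreIf f x y z) (centres f (y ∷ z ∷ r))) ⟩
    reverse (centres f (x ∷ y ∷ z ∷ r))
  ∎
  where open ≡-Reasoning

centres-cong-head : ∀ f x x' h T → (∀ t → f x h t ≡ f x' h t) → centres f (x ∷ h ∷ T) ≡ centres f (x' ∷ h ∷ T)
centres-cong-head f x x' h [] eq = refl
centres-cong-head f x x' h (t ∷ T) eq = cong (λ b → (if b then h ∷ [] else []) ++ centres f (h ∷ t ∷ T)) (eq t)

centres-cong-last : ∀ f W l y y' → (∀ t → f t l y ≡ f t l y') → centres f (W ++ l ∷ y ∷ []) ≡ centres f (W ++ l ∷ y' ∷ [])
centres-cong-last f W l y y' eq with reverseView W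
... | Reverse.[] = refl
... | W₀ ∶ _ ∶ʳ t rewrite ++-assoc W₀ (t ∷ []) (l ∷ y ∷ []) | ++-assoc W₀ (t ∷ []) (l ∷ y' ∷ [])
       | centres-∷ʳ f W₀ t l y | centres-∷ʳ f W₀ t l y' =
  cong (λ b → centres f (W₀ ++ t ∷ l ∷ []) ++ (if b then l ∷ [] else [])) (eq t)

-- Runs of an extended permutation

-- Adjacent entries differ and the last step goes up, as in every extended permutation.
WellFormed : List ℕ → Set
WellFormed (a ∷ b ∷ []) = a < b
WellFormed (a ∷ b ∷ c ∷ r) = (a ≢ b) × WellFormed (b ∷ c ∷ r)
WellFormed _ = ⊥

WellFormed-≢ : ∀ b c r → WellFormed (b ∷ c ∷ r) → b ≢ c
WellFormed-≢ b c [] g refl = <-irrefl refl g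
WellFormed-≢ b c (_ ∷ _) (ne , _) = ne

WellFormed-≮⇒> : ∀ b c r → ¬ b < c → WellFormed (b ∷ c ∷ r) → c < b
WellFormed-≮⇒> b c r b≮c g = ≤∧≢⇒< (≮⇒≥ b≮c) (WellFormed-≢ b c r g ∘ sym)

Descending : List ℕ → Set
Descending (x ∷ y ∷ r) = y < x × Descending (y ∷ r)
Descending _ = ⊤

record DescentRun (a b : ℕ) (r : List ℕ) : Set where
  field
    D : List ℕ
    v z : ℕ
    r' : List ℕ
    eq : b ∷ r ≡ D ++ v ∷ z ∷ r'
    dec : Descending (a ∷ D ++ v ∷ [])
    v<z : v < z
    good : WellFormed (v ∷ z ∷ r')
    vall : valleys (a ∷ b ∷ r) ≡ v ∷ valleys (v ∷ z ∷ r')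
    peak : peaks (a ∷ b ∷ r) ≡ peaks (v ∷ z ∷ r')

descentRun : ∀ a b r → b < a → WellFormed (a ∷ b ∷ r) → DescentRun a b r
descentRun a b [] b<a g = ⊥-elim (<-asym b<a g)
descentRun a b (c ∷ r) b<a (a≢b , g) with b <? c
... | yes b<c = record
  { D = [] ; v = b ; z = c ; r' = r ; eq = refl ; dec = b<a , tt ; v<z = b<c ; good = g
  ; vall = valleys-∷-true r (isValley-true b<a b<c)
  ; peak = peaks-∷-false r (isPeak-falseˡ c (<-asym b<a)) }
... | no b≮c = record
  { D = b ∷ D ; v = v ; z = z ; r' = r' ; eq = cong (b ∷_) eq ; dec = b<a , dec ; v<z = v<z ; good = good
  ; vall = trans (valleys-∷-false r (isValley-falseʳ a b≮c)) vall
  ; peak = trans (peaks-∷-false r (isPeak-falseˡ c (<-asym b<a))) peak }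
  where open DescentRun (descentRun b c r (WellFormed-≮⇒> b c r b≮c g) g)

record AscentRun (a b : ℕ) (r : List ℕ) : Set where
  field
    U : List ℕ
    y y' : ℕ
    r' : List ℕ
    eq : b ∷ r ≡ U ++ y ∷ y' ∷ r'
    y'<y : y' < y
    good : WellFormed (y ∷ y' ∷ r')
    peak : peaks (a ∷ b ∷ r) ≡ y ∷ peaks (y ∷ y' ∷ r')
    vall : valleys (a ∷ b ∷ r) ≡ valleys (y ∷ y' ∷ r')

ascentRun : ∀ a b r → a < b → WellFormed (a ∷ b ∷ r) → peaks (a ∷ b ∷ r) ≡ [] ⊎ AscentRun a b r
ascentRun a b [] a<b g = inj₁ refl
ascentRun a b (c ∷ r) a<b (_ , g) with <-cmp b c
... | tri≈ _ e _ = ⊥-elim (WellFormed-≢ b c r g e)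
... | tri> _ _ c<b = inj₂ (record
  { U = [] ; y = b ; y' = c ; r' = r ; eq = refl ; y'<y = c<b ; good = g
  ; peak = peaks-∷-true r (isPeak-true a<b c<b)
  ; vall = valleys-∷-false r (isValley-falseˡ c (<-asym a<b)) })
... | tri< b<c _ c≮b with ascentRun b c r b<c g
...   | inj₁ p = inj₁ (trans (peaks-∷-false r (isPeak-falseʳ a c≮b)) p)
...   | inj₂ R = inj₂ (record
  { U = b ∷ U ; y = y ; y' = y' ; r' = r' ; eq = cong (b ∷_) eq ; y'<y = y'<y ; good = good
  ; peak = trans (peaks-∷-false r (isPeak-falseʳ a c≮b)) peak
  ; vall = trans (valleys-∷-false r (isValley-falseˡ c (<-asym a<b))) vall })
  where open AscentRun R

-- `IsPin m s a`: a is y_m of the extended permutation s, where y_0 is its first entry.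
IsPin : ℕ → List ℕ → ℕ → Set
IsPin zero s a = ∃ λ r → s ≡ a ∷ r
IsPin (suc m) s a = ∀ d → nth (peaks s) m d ≡ a

IsPin-∷ : ∀ m y₁ P s a → IsPin m s a → peaks s ≡ P → (∀ r → s ≡ a ∷ r → y₁ ≡ a) → ∀ d → nth (y₁ ∷ P) m d ≡ a
IsPin-∷ zero y₁ P s a (r , e) _ h d = h r e
IsPin-∷ (suc m) y₁ P s a t refl h d = t d

-- s cut at y_m, the top of its m-th descent.
record FromPin (m : ℕ) (s : List ℕ) : Set where
  field
    Pre : List ℕ
    a b : ℕ
    r : List ℕ
    eq : s ≡ Pre ++ a ∷ b ∷ r
    b<a : b < a
    good : WellFormed (a ∷ b ∷ r)
    vnth : ∀ t d → nth (valleys s) (m + t) d ≡ nth (valleys (a ∷ b ∷ r)) t d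
    pnth : ∀ t d → nth (peaks s) (m + t) d ≡ nth (peaks (a ∷ b ∷ r)) t d
    len : length (peaks s) ≡ m + length (peaks (a ∷ b ∷ r))
    top : IsPin m s a

fromPin : ∀ m x y r → y < x → WellFormed (x ∷ y ∷ r) → m ≤ length (peaks (x ∷ y ∷ r)) → FromPin m (x ∷ y ∷ r)
fromPin zero x y r y<x g _ = record
  { Pre = [] ; a = x ; b = y ; r = r ; eq = refl ; b<a = y<x ; good = g
  ; vnth = λ t d → refl ; pnth = λ t d → refl ; len = refl ; top = y ∷ r , refl }
fromPin (suc m) x y r y<x g le with descentRun x y r y<x g
... | record { D = D ; v = v ; z = z ; r' = r' ; eq = eqD ; v<z = v<z ; good = gD ; vall = vallD ; peak = peakD }
  with ascentRun v z r' v<z gD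
...   | inj₁ p = ⊥-elim (n≮0 (subst (suc m ≤_) (cong length (trans peakD p)) le))
...   | inj₂ record { U = U ; y = y₁ ; y' = y' ; r' = r'' ; eq = eqA ; y'<y = y'<y ; good = gA ; peak = peakA ; vall = vallA } =
  record
  { Pre = x ∷ D ++ v ∷ U ++ Pre ; a = a ; b = b ; r = r₁ ; b<a = b<a ; good = good
  ; eq = cong (x ∷_) (trans eqD (trans (cong (λ t → D ++ v ∷ t) eqA) (trans (cong (λ t → D ++ v ∷ U ++ t) eq) reassoc)))
  ; vnth = λ t d → trans (cong (λ l → nth l (suc m + t) d) (trans vallD (cong (v ∷_) vallA))) (vnth t d)
  ; pnth = λ t d → trans (cong (λ l → nth l (suc m + t) d) peaks≡) (pnth t d)
  ; len = trans (cong length peaks≡) (cong suc len)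
  ; top = λ d → trans (cong (λ l → nth l m d) peaks≡) (IsPin-∷ m y₁ _ (y₁ ∷ y' ∷ r'') a top refl (λ _ e → ∷-injectiveˡ e) d) }
  where
  peaks≡ : peaks (x ∷ y ∷ r) ≡ y₁ ∷ peaks (y₁ ∷ y' ∷ r'')
  peaks≡ = trans peakD peakA
  S : FromPin m (y₁ ∷ y' ∷ r'')
  S = fromPin m y₁ y' r'' y'<y gA (≤-pred (≤-trans le (≤-reflexive (cong length peaks≡))))
  open FromPin S renaming (r to r₁)
  reassoc : D ++ v ∷ U ++ Pre ++ a ∷ b ∷ r₁ ≡ (D ++ v ∷ U ++ Pre) ++ a ∷ b ∷ r₁
  reassoc = sym (trans (++-assoc D (v ∷ U ++ Pre) _) (cong (λ t → D ++ v ∷ t) (++-assoc U Pre _)))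

-- Peaks and valleys around a moved entry

centreIf-false : ∀ f a b c → f a b c ≡ false → centreIf f a b c ≡ []
centreIf-false f a b c e rewrite e = refl

centreIf-true : ∀ f a b c → f a b c ≡ true → centreIf f a b c ≡ b ∷ []
centreIf-true f a b c e rewrite e = refl

centres-frame : ∀ f P x y M a b R → centres f (P ++ x ∷ y ∷ M ++ a ∷ b ∷ R)
        ≡ centres f (P ++ x ∷ y ∷ []) ++ centres f (x ∷ y ∷ M ++ a ∷ b ∷ []) ++ centres f (a ∷ b ∷ R)
centres-frame f P x y M a b R =
  trans (centres-++ f P x y (M ++ a ∷ b ∷ R))
        (cong (centres f (P ++ x ∷ y ∷ []) ++_) (centres-++ f (x ∷ y ∷ M) a b R))

centres-extend₁ : ∀ f x K K0 l a b → K ≡ K0 ++ l ∷ [] →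
     centres f (x ∷ K ++ a ∷ b ∷ []) ≡ centres f (x ∷ K ++ a ∷ []) ++ centreIf f l a b
centres-extend₁ f x K K0 l a b refl =
  begin
    centres f (x ∷ (K0 ++ l ∷ []) ++ a ∷ b ∷ [])
  ≡⟨ cong (λ t → centres f (x ∷ t)) (++-assoc K0 (l ∷ []) (a ∷ b ∷ [])) ⟩
    centres f ((x ∷ K0) ++ l ∷ a ∷ b ∷ [])
  ≡⟨ centres-∷ʳ f (x ∷ K0) l a b ⟩
    centres f ((x ∷ K0) ++ l ∷ a ∷ []) ++ centreIf f l a b
  ≡⟨ cong (λ t → centres f (x ∷ t) ++ centreIf f l a b) (sym (++-assoc K0 (l ∷ []) (a ∷ []))) ⟩
    centres f (x ∷ (K0 ++ l ∷ []) ++ a ∷ []) ++ centreIf f l a b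
  ∎
  where open ≡-Reasoning

centres-extend₂ : ∀ f x K K0 l a b c → K ≡ K0 ++ l ∷ [] →
     centres f (x ∷ K ++ a ∷ b ∷ c ∷ []) ≡ centres f (x ∷ K ++ a ∷ []) ++ centreIf f l a b ++ centreIf f a b c
centres-extend₂ f x K K0 l a b c refl =
  begin
    centres f (x ∷ (K0 ++ l ∷ []) ++ a ∷ b ∷ c ∷ [])
  ≡⟨ cong (λ t → centres f (x ∷ t)) (++-assoc K0 (l ∷ []) (a ∷ b ∷ c ∷ [])) ⟩
    centres f ((x ∷ K0) ++ l ∷ a ∷ b ∷ c ∷ [])
  ≡⟨ centres-++ f (x ∷ K0) l a (b ∷ c ∷ []) ⟩
    centres f ((x ∷ K0) ++ l ∷ a ∷ []) ++ (centreIf f l a b ++ centreIf f a b c ++ [])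
  ≡⟨ cong₂ _++_ (cong (λ t → centres f (x ∷ t)) (sym (++-assoc K0 (l ∷ []) (a ∷ [])))) (cong (centreIf f l a b ++_) (++-identityʳ (centreIf f a b c))) ⟩
    centres f (x ∷ (K0 ++ l ∷ []) ++ a ∷ []) ++ centreIf f l a b ++ centreIf f a b c
  ∎
  where open ≡-Reasoning

centres-cong-ends : ∀ f x x' K w K' K0 l y y' → K ≡ w ∷ K' → K ≡ K0 ++ l ∷ [] →
        (∀ t → f x w t ≡ f x' w t) → (∀ t → f t l y ≡ f t l y') →
        centres f (x ∷ K ++ y ∷ []) ≡ centres f (x' ∷ K ++ y' ∷ [])
centres-cong-ends f x x' K w K' K0 l y y' h1 h2 ex ey =
  trans (subst (λ K → centres f (x ∷ K ++ y ∷ []) ≡ centres f (x' ∷ K ++ y ∷ [])) (sym h1) (centres-cong-head f x x' w (K' ++ y ∷ []) ex))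
        (subst (λ K → centres f (x' ∷ K ++ y ∷ []) ≡ centres f (x' ∷ K ++ y' ∷ [])) (sym h2)
          (trans (cong (λ t → centres f (x' ∷ t)) (++-assoc K0 (l ∷ []) (y ∷ [])))
           (trans (centres-cong-last f (x' ∷ K0) l y y' ey)
            (cong (λ t → centres f (x' ∷ t)) (sym (++-assoc K0 (l ∷ []) (y' ∷ [])))))))

reverse-∷-∷ʳ : ∀ (x : ℕ) K y → reverse (y ∷ K ++ x ∷ []) ≡ x ∷ reverse K ++ y ∷ []
reverse-∷-∷ʳ x K y = trans (unfold-reverse y (K ++ x ∷ []))
                   (cong (_++ y ∷ []) (reverse-++ K (x ∷ [])))

centres-reverse-inner : ∀ f → Reversible f → ∀ x K y → centres f (x ∷ reverse K ++ y ∷ []) ≡ reverse (centres f (y ∷ K ++ x ∷ []))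
centres-reverse-inner f s x K y = trans (cong (centres f) (sym (reverse-∷-∷ʳ x K y))) (centres-reverse f s (y ∷ K ++ x ∷ []))

neighbourˡ-below : ∀ {x x' w} → x < w → x' < w → (∀ t → isPeak x w t ≡ isPeak x' w t) × (∀ t → isValley x w t ≡ isValley x' w t)
neighbourˡ-below {x} {x'} {w} p q = (λ t → cong (_∧ ⌊ t <? w ⌋) (trans (⌊<?⌋-true p) (sym (⌊<?⌋-true q))))
                        , (λ t → cong (_∧ ⌊ w <? t ⌋) (trans (⌊<?⌋-false (<-asym p)) (sym (⌊<?⌋-false (<-asym q)))))
neighbourˡ-above : ∀ {x x' w} → w < x → w < x' → (∀ t → isPeak x w t ≡ isPeak x' w t) × (∀ t → isValley x w t ≡ isValley x' w t)
neighbourˡ-above {x} {x'} {w} p q = (λ t → cong (_∧ ⌊ t <? w ⌋) (trans (⌊<?⌋-false (<-asym p)) (sym (⌊<?⌋-false (<-asym q)))))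
                        , (λ t → cong (_∧ ⌊ w <? t ⌋) (trans (⌊<?⌋-true p) (sym (⌊<?⌋-true q))))
neighbourʳ-below : ∀ {y y' l} → y < l → y' < l → (∀ t → isPeak t l y ≡ isPeak t l y') × (∀ t → isValley t l y ≡ isValley t l y')
neighbourʳ-below {y} {y'} {l} p q = (λ t → cong (⌊ t <? l ⌋ ∧_) (trans (⌊<?⌋-true p) (sym (⌊<?⌋-true q))))
                         , (λ t → cong (⌊ l <? t ⌋ ∧_) (trans (⌊<?⌋-false (<-asym p)) (sym (⌊<?⌋-false (<-asym q)))))
neighbourʳ-above : ∀ {y y' l} → l < y → l < y' → (∀ t → isPeak t l y ≡ isPeak t l y') × (∀ t → isValley t l y ≡ isValley t l y')
neighbourʳ-above {y} {y'} {l} p q = (λ t → cong (⌊ t <? l ⌋ ∧_) (trans (⌊<?⌋-false (<-asym p)) (sym (⌊<?⌋-false (<-asym q)))))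
                         , (λ t → cong (⌊ l <? t ⌋ ∧_) (trans (⌊<?⌋-true p) (sym (⌊<?⌋-true q))))

module CentresRight (f : TriplePred) (P : List ℕ) (v u : ℕ) (K : List ℕ) (w : ℕ) (K' K0 : List ℕ) (d c z : ℕ) (R : List ℕ)
             (K-head : K ≡ w ∷ K') (K-last : K ≡ K0 ++ d ∷ []) where
  open ≡-Reasoning

  centres-before : centres f (P ++ v ∷ u ∷ K ++ c ∷ z ∷ R)
       ≡ centres f (P ++ v ∷ u ∷ []) ++ (centreIf f v u w ++ centres f (u ∷ K ++ c ∷ []) ++ centreIf f d c z) ++ centres f (c ∷ z ∷ R)
  centres-before = begin
      centres f (P ++ v ∷ u ∷ K ++ c ∷ z ∷ R)
    ≡⟨ centres-frame f P v u K c z R ⟩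
      centres f (P ++ v ∷ u ∷ []) ++ centres f (v ∷ u ∷ K ++ c ∷ z ∷ []) ++ centres f (c ∷ z ∷ R)
    ≡⟨ cong (λ t → centres f (P ++ v ∷ u ∷ []) ++ t ++ centres f (c ∷ z ∷ R)) mid ⟩
      centres f (P ++ v ∷ u ∷ []) ++ (centreIf f v u w ++ centres f (u ∷ K ++ c ∷ []) ++ centreIf f d c z) ++ centres f (c ∷ z ∷ R)
    ∎
    where
    mid0 : centres f (v ∷ u ∷ K ++ c ∷ z ∷ []) ≡ centreIf f v u w ++ centres f (u ∷ K ++ c ∷ z ∷ [])
    mid0 rewrite K-head = refl
    mid : centres f (v ∷ u ∷ K ++ c ∷ z ∷ []) ≡ centreIf f v u w ++ centres f (u ∷ K ++ c ∷ []) ++ centreIf f d c z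
    mid = trans mid0 (cong (centreIf f v u w ++_) (centres-extend₁ f u K K0 d c z K-last))

  centres-after : centres f (P ++ v ∷ K ++ u ∷ c ∷ z ∷ R)
       ≡ centres f (P ++ v ∷ w ∷ []) ++ (centres f (v ∷ K ++ u ∷ []) ++ centreIf f d u c ++ centreIf f u c z) ++ centres f (c ∷ z ∷ R)
  centres-after = begin
      centres f (P ++ v ∷ K ++ u ∷ c ∷ z ∷ R)
    ≡⟨ cong (λ t → centres f (P ++ v ∷ t)) eqL ⟩
      centres f (P ++ v ∷ w ∷ (K' ++ u ∷ []) ++ c ∷ z ∷ R)
    ≡⟨ centres-frame f P v w (K' ++ u ∷ []) c z R ⟩
      centres f (P ++ v ∷ w ∷ []) ++ centres f (v ∷ w ∷ (K' ++ u ∷ []) ++ c ∷ z ∷ []) ++ centres f (c ∷ z ∷ R)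
    ≡⟨ cong (λ t → centres f (P ++ v ∷ w ∷ []) ++ t ++ centres f (c ∷ z ∷ R)) mid ⟩
      centres f (P ++ v ∷ w ∷ []) ++ (centres f (v ∷ K ++ u ∷ []) ++ centreIf f d u c ++ centreIf f u c z) ++ centres f (c ∷ z ∷ R)
    ∎
    where
    eqL : K ++ u ∷ c ∷ z ∷ R ≡ w ∷ (K' ++ u ∷ []) ++ c ∷ z ∷ R
    eqL rewrite K-head = cong (w ∷_) (sym (++-assoc K' (u ∷ []) (c ∷ z ∷ R)))
    eqM : w ∷ (K' ++ u ∷ []) ++ c ∷ z ∷ [] ≡ K ++ u ∷ c ∷ z ∷ []
    eqM rewrite K-head = cong (w ∷_) (++-assoc K' (u ∷ []) (c ∷ z ∷ []))
    mid : centres f (v ∷ w ∷ (K' ++ u ∷ []) ++ c ∷ z ∷ []) ≡ centres f (v ∷ K ++ u ∷ []) ++ centreIf f d u c ++ centreIf f u c z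
    mid = trans (cong (λ t → centres f (v ∷ t)) eqM) (centres-extend₂ f v K K0 d u c z K-last)

  revK1 : reverse K ≡ d ∷ reverse K0
  revK1 rewrite K-last = reverse-++ K0 (d ∷ [])
  revK2 : reverse K ≡ reverse K' ++ w ∷ []
  revK2 rewrite K-head = unfold-reverse w K'

  centres-between : centres f (P ++ v ∷ reverse K ++ u ∷ c ∷ z ∷ R)
       ≡ centres f (P ++ v ∷ d ∷ []) ++ (centres f (v ∷ reverse K ++ u ∷ []) ++ centreIf f w u c ++ centreIf f u c z) ++ centres f (c ∷ z ∷ R)
  centres-between = begin
      centres f (P ++ v ∷ reverse K ++ u ∷ c ∷ z ∷ R)
    ≡⟨ cong (λ t → centres f (P ++ v ∷ t)) eqL ⟩
      centres f (P ++ v ∷ d ∷ (reverse K0 ++ u ∷ []) ++ c ∷ z ∷ R)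
    ≡⟨ centres-frame f P v d (reverse K0 ++ u ∷ []) c z R ⟩
      centres f (P ++ v ∷ d ∷ []) ++ centres f (v ∷ d ∷ (reverse K0 ++ u ∷ []) ++ c ∷ z ∷ []) ++ centres f (c ∷ z ∷ R)
    ≡⟨ cong (λ t → centres f (P ++ v ∷ d ∷ []) ++ t ++ centres f (c ∷ z ∷ R)) mid ⟩
      centres f (P ++ v ∷ d ∷ []) ++ (centres f (v ∷ reverse K ++ u ∷ []) ++ centreIf f w u c ++ centreIf f u c z) ++ centres f (c ∷ z ∷ R)
    ∎
    where
    eqL : reverse K ++ u ∷ c ∷ z ∷ R ≡ d ∷ (reverse K0 ++ u ∷ []) ++ c ∷ z ∷ R
    eqL rewrite revK1 = cong (d ∷_) (sym (++-assoc (reverse K0) (u ∷ []) (c ∷ z ∷ R)))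
    eqM : d ∷ (reverse K0 ++ u ∷ []) ++ c ∷ z ∷ [] ≡ reverse K ++ u ∷ c ∷ z ∷ []
    eqM rewrite revK1 = cong (d ∷_) (++-assoc (reverse K0) (u ∷ []) (c ∷ z ∷ []))
    mid : centres f (v ∷ d ∷ (reverse K0 ++ u ∷ []) ++ c ∷ z ∷ []) ≡ centres f (v ∷ reverse K ++ u ∷ []) ++ centreIf f w u c ++ centreIf f u c z
    mid = trans (cong (λ t → centres f (v ∷ t)) eqM) (centres-extend₂ f v (reverse K) (reverse K') w u c z revK2)

module CentresLeft (f : TriplePred) (P : List ℕ) (dd u : ℕ) (K : List ℕ) (c : ℕ) (K' K0 : List ℕ) (v z : ℕ) (R : List ℕ)
             (K-head : K ≡ c ∷ K') (K-last : K ≡ K0 ++ v ∷ []) where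
  open ≡-Reasoning

  centres-before : centres f (P ++ dd ∷ K ++ u ∷ z ∷ R)
       ≡ centres f (P ++ dd ∷ c ∷ []) ++ (centres f (dd ∷ K ++ u ∷ []) ++ centreIf f v u z) ++ centres f (u ∷ z ∷ R)
  centres-before = begin
      centres f (P ++ dd ∷ K ++ u ∷ z ∷ R)
    ≡⟨ cong (λ t → centres f (P ++ dd ∷ t ++ u ∷ z ∷ R)) K-head ⟩
      centres f (P ++ dd ∷ c ∷ K' ++ u ∷ z ∷ R)
    ≡⟨ centres-frame f P dd c K' u z R ⟩
      centres f (P ++ dd ∷ c ∷ []) ++ centres f (dd ∷ c ∷ K' ++ u ∷ z ∷ []) ++ centres f (u ∷ z ∷ R)
    ≡⟨ cong (λ t → centres f (P ++ dd ∷ c ∷ []) ++ t ++ centres f (u ∷ z ∷ R)) mid ⟩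
      centres f (P ++ dd ∷ c ∷ []) ++ (centres f (dd ∷ K ++ u ∷ []) ++ centreIf f v u z) ++ centres f (u ∷ z ∷ R)
    ∎
    where
    mid : centres f (dd ∷ c ∷ K' ++ u ∷ z ∷ []) ≡ centres f (dd ∷ K ++ u ∷ []) ++ centreIf f v u z
    mid = trans (cong (λ t → centres f (dd ∷ t ++ u ∷ z ∷ [])) (sym K-head)) (centres-extend₁ f dd K K0 v u z K-last)

  centres-after : centres f (P ++ dd ∷ u ∷ K ++ z ∷ R)
       ≡ centres f (P ++ dd ∷ u ∷ []) ++ (centreIf f dd u c ++ centres f (u ∷ K ++ z ∷ [])) ++ centres f (v ∷ z ∷ R)
  centres-after = begin
      centres f (P ++ dd ∷ u ∷ K ++ z ∷ R)
    ≡⟨ cong (λ t → centres f (P ++ dd ∷ u ∷ t)) eqL ⟩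
      centres f (P ++ dd ∷ u ∷ K0 ++ v ∷ z ∷ R)
    ≡⟨ centres-frame f P dd u K0 v z R ⟩
      centres f (P ++ dd ∷ u ∷ []) ++ centres f (dd ∷ u ∷ K0 ++ v ∷ z ∷ []) ++ centres f (v ∷ z ∷ R)
    ≡⟨ cong (λ t → centres f (P ++ dd ∷ u ∷ []) ++ t ++ centres f (v ∷ z ∷ R)) mid ⟩
      centres f (P ++ dd ∷ u ∷ []) ++ (centreIf f dd u c ++ centres f (u ∷ K ++ z ∷ [])) ++ centres f (v ∷ z ∷ R)
    ∎
    where
    eqL : K ++ z ∷ R ≡ K0 ++ v ∷ z ∷ R
    eqL rewrite K-last = ++-assoc K0 (v ∷ []) (z ∷ R)
    eqM : K0 ++ v ∷ z ∷ [] ≡ c ∷ K' ++ z ∷ []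
    eqM rewrite sym (++-assoc K0 (v ∷ []) (z ∷ [])) | sym K-last | K-head = refl
    mid : centres f (dd ∷ u ∷ K0 ++ v ∷ z ∷ []) ≡ centreIf f dd u c ++ centres f (u ∷ K ++ z ∷ [])
    mid = trans (cong (λ t → centres f (dd ∷ u ∷ t)) eqM) (cong (λ t → centreIf f dd u c ++ centres f (u ∷ t ++ z ∷ [])) (sym K-head))

  revK1 : reverse K ≡ v ∷ reverse K0
  revK1 rewrite K-last = reverse-++ K0 (v ∷ [])
  revK2 : reverse K ≡ reverse K' ++ c ∷ []
  revK2 rewrite K-head = unfold-reverse c K'

  centres-between : centres f (P ++ dd ∷ u ∷ reverse K ++ z ∷ R)
       ≡ centres f (P ++ dd ∷ u ∷ []) ++ (centreIf f dd u v ++ centres f (u ∷ reverse K ++ z ∷ [])) ++ centres f (c ∷ z ∷ R)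
  centres-between = begin
      centres f (P ++ dd ∷ u ∷ reverse K ++ z ∷ R)
    ≡⟨ cong (λ t → centres f (P ++ dd ∷ u ∷ t)) eqL ⟩
      centres f (P ++ dd ∷ u ∷ reverse K' ++ c ∷ z ∷ R)
    ≡⟨ centres-frame f P dd u (reverse K') c z R ⟩
      centres f (P ++ dd ∷ u ∷ []) ++ centres f (dd ∷ u ∷ reverse K' ++ c ∷ z ∷ []) ++ centres f (c ∷ z ∷ R)
    ≡⟨ cong (λ t → centres f (P ++ dd ∷ u ∷ []) ++ t ++ centres f (c ∷ z ∷ R)) mid ⟩
      centres f (P ++ dd ∷ u ∷ []) ++ (centreIf f dd u v ++ centres f (u ∷ reverse K ++ z ∷ [])) ++ centres f (c ∷ z ∷ R)
    ∎
    where
    eqL : reverse K ++ z ∷ R ≡ reverse K' ++ c ∷ z ∷ R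
    eqL rewrite revK2 = ++-assoc (reverse K') (c ∷ []) (z ∷ R)
    eqM : reverse K' ++ c ∷ z ∷ [] ≡ v ∷ reverse K0 ++ z ∷ []
    eqM rewrite sym (++-assoc (reverse K') (c ∷ []) (z ∷ [])) | sym revK2 | revK1 = refl
    mid : centres f (dd ∷ u ∷ reverse K' ++ c ∷ z ∷ []) ≡ centreIf f dd u v ++ centres f (u ∷ reverse K ++ z ∷ [])
    mid = trans (cong (λ t → centres f (dd ∷ u ∷ t)) eqM) (cong (λ t → centreIf f dd u v ++ centres f (u ∷ t ++ z ∷ [])) (sym revK1))

-- Along E, Em, E'' (before, between and after the two reversals) the peaks change only
-- inside one block I, whose order the first reversal reverses and the second restores.
record PeakSplit (E Em E'' : List ℕ) : Set where
  field
    A I C : List ℕ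
    hE : centres isPeak E ≡ A ++ I ++ C
    hEm : centres isPeak Em ≡ A ++ reverse I ++ C
    hE'' : centres isPeak E'' ≡ A ++ I ++ C

++-cong₃ : ∀ {a a' b b' c c' : List ℕ} → a ≡ a' → b ≡ b' → c ≡ c' → a ++ b ++ c ≡ a' ++ b' ++ c'
++-cong₃ refl refl refl = refl

peaks-moveRight : ∀ P v u K w K' K0 d c z R → K ≡ w ∷ K' → K ≡ K0 ++ d ∷ [] →
          v < u → u < w → u < d → c < d → (c < u ⊎ c < z) →
          PeakSplit (P ++ v ∷ u ∷ K ++ c ∷ z ∷ R) (P ++ v ∷ reverse K ++ u ∷ c ∷ z ∷ R) (P ++ v ∷ K ++ u ∷ c ∷ z ∷ R)
peaks-moveRight P v u K w K' K0 d c z R K-head K-last v<u u<w u<d c<d cc =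
  record { A = centres isPeak (P ++ v ∷ u ∷ []) ; I = centres isPeak (u ∷ K ++ c ∷ []) ; C = centres isPeak (c ∷ z ∷ R)
         ; hE = trans centres-before (cong (λ t → centres isPeak (P ++ v ∷ u ∷ []) ++ t ++ centres isPeak (c ∷ z ∷ R)) block-before)
         ; hEm = trans centres-between (cong₂ (λ s t → s ++ t ++ centres isPeak (c ∷ z ∷ R)) (sym prefix-between) block-between)
         ; hE'' = trans centres-after (cong₂ (λ s t → s ++ t ++ centres isPeak (c ∷ z ∷ R)) (sym prefix-after) block-after) }
  where
  open CentresRight isPeak P v u K w K' K0 d c z R K-head K-last
  v<w : v < w
  v<w = <-trans v<u u<w
  v<d : v < d
  v<d = <-trans v<u u<d
  prefix-after : centres isPeak (P ++ v ∷ u ∷ []) ≡ centres isPeak (P ++ v ∷ w ∷ [])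
  prefix-after = centres-cong-last isPeak P v u w (proj₁ (neighbourʳ-above v<u v<w))
  prefix-between : centres isPeak (P ++ v ∷ u ∷ []) ≡ centres isPeak (P ++ v ∷ d ∷ [])
  prefix-between = centres-cong-last isPeak P v u d (proj₁ (neighbourʳ-above v<u v<d))
  none-vuw : centreIf isPeak v u w ≡ []
  none-vuw = centreIf-false isPeak v u w (isPeak-falseʳ v (<-asym u<w))
  none-dcz : centreIf isPeak d c z ≡ []
  none-dcz = centreIf-false isPeak d c z (isPeak-falseˡ z (<-asym c<d))
  none-duc : centreIf isPeak d u c ≡ []
  none-duc = centreIf-false isPeak d u c (isPeak-falseˡ c (<-asym u<d))
  none-ucz : centreIf isPeak u c z ≡ []
  none-ucz = centreIf-false isPeak u c z (c-not-peak cc)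
    where c-not-peak : (c < u ⊎ c < z) → isPeak u c z ≡ false
          c-not-peak (inj₁ c<u) = isPeak-falseˡ z (<-asym c<u)
          c-not-peak (inj₂ c<z) = isPeak-falseʳ u (<-asym c<z)
  none-wuc : centreIf isPeak w u c ≡ []
  none-wuc = centreIf-false isPeak w u c (isPeak-falseˡ c (<-asym u<w))
  inner-after : centres isPeak (v ∷ K ++ u ∷ []) ≡ centres isPeak (u ∷ K ++ c ∷ [])
  inner-after = centres-cong-ends isPeak v u K w K' K0 d u c K-head K-last (proj₁ (neighbourˡ-below v<w u<w)) (proj₁ (neighbourʳ-below u<d c<d))
  inner-between : centres isPeak (u ∷ K ++ v ∷ []) ≡ centres isPeak (u ∷ K ++ c ∷ [])
  inner-between = centres-cong-ends isPeak u u K w K' K0 d v c K-head K-last (λ t → refl) (proj₁ (neighbourʳ-below v<d c<d))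
  block-before : centreIf isPeak v u w ++ centres isPeak (u ∷ K ++ c ∷ []) ++ centreIf isPeak d c z ≡ centres isPeak (u ∷ K ++ c ∷ [])
  block-before rewrite none-vuw | none-dcz = ++-identityʳ _
  block-after : centres isPeak (v ∷ K ++ u ∷ []) ++ centreIf isPeak d u c ++ centreIf isPeak u c z ≡ centres isPeak (u ∷ K ++ c ∷ [])
  block-after rewrite none-duc | none-ucz = trans (++-identityʳ _) inner-after
  block-between : centres isPeak (v ∷ reverse K ++ u ∷ []) ++ centreIf isPeak w u c ++ centreIf isPeak u c z ≡ reverse (centres isPeak (u ∷ K ++ c ∷ []))
  block-between rewrite none-wuc | none-ucz = trans (++-identityʳ _) (trans (centres-reverse-inner isPeak isPeak-reversible v K u) (cong reverse inner-between))

peaks-moveLeft : ∀ P dd u K c K' K0 v z R → K ≡ c ∷ K' → K ≡ K0 ++ v ∷ [] →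
          c < dd → u < dd → c < u → v < u → u < z →
          PeakSplit (P ++ dd ∷ K ++ u ∷ z ∷ R) (P ++ dd ∷ u ∷ reverse K ++ z ∷ R) (P ++ dd ∷ u ∷ K ++ z ∷ R)
peaks-moveLeft P dd u K c K' K0 v z R K-head K-last c<dd u<dd c<u v<u u<z =
  record { A = centres isPeak (P ++ dd ∷ c ∷ []) ; I = centres isPeak (dd ∷ K ++ u ∷ []) ; C = centres isPeak (u ∷ z ∷ R)
         ; hE = trans centres-before (cong (λ t → centres isPeak (P ++ dd ∷ c ∷ []) ++ t ++ centres isPeak (u ∷ z ∷ R)) block-before)
         ; hEm = trans centres-between (++-cong₃ (sym prefix) block-between suffix-between)
         ; hE'' = trans centres-after (++-cong₃ (sym prefix) block-after suffix-after) }
  where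
  open CentresLeft isPeak P dd u K c K' K0 v z R K-head K-last
  v<z : v < z
  v<z = <-trans v<u u<z
  c<z : c < z
  c<z = <-trans c<u u<z
  prefix : centres isPeak (P ++ dd ∷ c ∷ []) ≡ centres isPeak (P ++ dd ∷ u ∷ [])
  prefix = centres-cong-last isPeak P dd c u (proj₁ (neighbourʳ-below c<dd u<dd))
  suffix-after : centres isPeak (v ∷ z ∷ R) ≡ centres isPeak (u ∷ z ∷ R)
  suffix-after = centres-cong-head isPeak v u z R (proj₁ (neighbourˡ-below v<z u<z))
  suffix-between : centres isPeak (c ∷ z ∷ R) ≡ centres isPeak (u ∷ z ∷ R)
  suffix-between = centres-cong-head isPeak c u z R (proj₁ (neighbourˡ-below c<z u<z))
  none-vuz : centreIf isPeak v u z ≡ []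
  none-vuz = centreIf-false isPeak v u z (isPeak-falseʳ v (<-asym u<z))
  none-duc : centreIf isPeak dd u c ≡ []
  none-duc = centreIf-false isPeak dd u c (isPeak-falseˡ c (<-asym u<dd))
  none-duv : centreIf isPeak dd u v ≡ []
  none-duv = centreIf-false isPeak dd u v (isPeak-falseˡ v (<-asym u<dd))
  inner-after : centres isPeak (u ∷ K ++ z ∷ []) ≡ centres isPeak (dd ∷ K ++ u ∷ [])
  inner-after = centres-cong-ends isPeak u dd K c K' K0 v z u K-head K-last (proj₁ (neighbourˡ-above c<u c<dd)) (proj₁ (neighbourʳ-above v<z v<u))
  inner-between : centres isPeak (z ∷ K ++ u ∷ []) ≡ centres isPeak (dd ∷ K ++ u ∷ [])
  inner-between = centres-cong-ends isPeak z dd K c K' K0 v u u K-head K-last (proj₁ (neighbourˡ-above c<z c<dd)) (λ t → refl)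
  block-before : centres isPeak (dd ∷ K ++ u ∷ []) ++ centreIf isPeak v u z ≡ centres isPeak (dd ∷ K ++ u ∷ [])
  block-before rewrite none-vuz = ++-identityʳ _
  block-after : centreIf isPeak dd u c ++ centres isPeak (u ∷ K ++ z ∷ []) ≡ centres isPeak (dd ∷ K ++ u ∷ [])
  block-after rewrite none-duc = inner-after
  block-between : centreIf isPeak dd u v ++ centres isPeak (u ∷ reverse K ++ z ∷ []) ≡ reverse (centres isPeak (dd ∷ K ++ u ∷ []))
  block-between rewrite none-duv = trans (centres-reverse-inner isPeak isPeak-reversible u K z) (cong reverse inner-between)

valleys-moveRight-below : ∀ P v u K w K' K0 d c z R → K ≡ w ∷ K' → K ≡ K0 ++ d ∷ [] →
          v < u → u < w → u < d → c < u →
          centres isValley (P ++ v ∷ K ++ u ∷ c ∷ z ∷ R) ≡ centres isValley (P ++ v ∷ u ∷ K ++ c ∷ z ∷ R)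
valleys-moveRight-below P v u K w K' K0 d c z R K-head K-last v<u u<w u<d c<u =
  trans Scan.centres-after (trans (cong (λ t → t ++ _ ++ centres isValley (c ∷ z ∷ R)) (sym prefix-after))
    (trans (cong (λ t → centres isValley (P ++ v ∷ u ∷ []) ++ t ++ centres isValley (c ∷ z ∷ R)) (trans block-after (sym block-before))) (sym Scan.centres-before)))
  where
  module Scan = CentresRight isValley P v u K w K' K0 d c z R K-head K-last
  v<w : v < w
  v<w = <-trans v<u u<w
  c<d : c < d
  c<d = <-trans c<u u<d
  prefix-after : centres isValley (P ++ v ∷ u ∷ []) ≡ centres isValley (P ++ v ∷ w ∷ [])
  prefix-after = centres-cong-last isValley P v u w (proj₂ (neighbourʳ-above v<u v<w))
  none-vuw : centreIf isValley v u w ≡ []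
  none-vuw = centreIf-false isValley v u w (isValley-falseˡ w (<-asym v<u))
  none-duc : centreIf isValley d u c ≡ []
  none-duc = centreIf-false isValley d u c (isValley-falseʳ d (<-asym c<u))
  same-ucz : centreIf isValley u c z ≡ centreIf isValley d c z
  same-ucz = cong (λ t → if t ∧ ⌊ c <? z ⌋ then c ∷ [] else []) (trans (⌊<?⌋-true c<u) (sym (⌊<?⌋-true c<d)))
  inner-after : centres isValley (v ∷ K ++ u ∷ []) ≡ centres isValley (u ∷ K ++ c ∷ [])
  inner-after = centres-cong-ends isValley v u K w K' K0 d u c K-head K-last (proj₂ (neighbourˡ-below v<w u<w)) (proj₂ (neighbourʳ-below u<d c<d))
  block-before : centreIf isValley v u w ++ centres isValley (u ∷ K ++ c ∷ []) ++ centreIf isValley d c z ≡ centres isValley (u ∷ K ++ c ∷ []) ++ centreIf isValley d c z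
  block-before rewrite none-vuw = refl
  block-after : centres isValley (v ∷ K ++ u ∷ []) ++ centreIf isValley d u c ++ centreIf isValley u c z ≡ centres isValley (u ∷ K ++ c ∷ []) ++ centreIf isValley d c z
  block-after rewrite none-duc | same-ucz = cong (_++ centreIf isValley d c z) inner-after

valleys-moveRight-above : ∀ P v u K w K' K0 d c z R → K ≡ w ∷ K' → K ≡ K0 ++ d ∷ [] →
          v < u → u < w → u < d → u < c → c < d → c < z →
          (centres isValley (P ++ v ∷ u ∷ K ++ c ∷ z ∷ R) ≡ (centres isValley (P ++ v ∷ u ∷ []) ++ centres isValley (u ∷ K ++ c ∷ [])) ++ c ∷ centres isValley (c ∷ z ∷ R))
          × (centres isValley (P ++ v ∷ K ++ u ∷ c ∷ z ∷ R) ≡ (centres isValley (P ++ v ∷ u ∷ []) ++ centres isValley (u ∷ K ++ c ∷ [])) ++ u ∷ centres isValley (c ∷ z ∷ R))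
valleys-moveRight-above P v u K w K' K0 d c z R K-head K-last v<u u<w u<d u<c c<d c<z =
  trans Scan.centres-before (trans (cong (λ t → centres isValley (P ++ v ∷ u ∷ []) ++ t ++ centres isValley (c ∷ z ∷ R)) block-before) (++-∷-reassoc (centres isValley (P ++ v ∷ u ∷ [])) (centres isValley (u ∷ K ++ c ∷ [])) c (centres isValley (c ∷ z ∷ R))))
  , trans Scan.centres-after (trans (cong₂ (λ s t → s ++ t ++ centres isValley (c ∷ z ∷ R)) (sym prefix-after) block-after) (++-∷-reassoc (centres isValley (P ++ v ∷ u ∷ [])) (centres isValley (u ∷ K ++ c ∷ [])) u (centres isValley (c ∷ z ∷ R))))
  where
  module Scan = CentresRight isValley P v u K w K' K0 d c z R K-head K-last
  ++-∷-reassoc : ∀ (a b : List ℕ) x (c : List ℕ) → a ++ (b ++ x ∷ []) ++ c ≡ (a ++ b) ++ x ∷ c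
  ++-∷-reassoc a b x c = trans (cong (a ++_) (++-assoc b (x ∷ []) c)) (sym (++-assoc a b (x ∷ c)))
  v<w : v < w
  v<w = <-trans v<u u<w
  prefix-after : centres isValley (P ++ v ∷ u ∷ []) ≡ centres isValley (P ++ v ∷ w ∷ [])
  prefix-after = centres-cong-last isValley P v u w (proj₂ (neighbourʳ-above v<u v<w))
  none-vuw : centreIf isValley v u w ≡ []
  none-vuw = centreIf-false isValley v u w (isValley-falseˡ w (<-asym v<u))
  one-dcz : centreIf isValley d c z ≡ c ∷ []
  one-dcz = centreIf-true isValley d c z (isValley-true c<d c<z)
  one-duc : centreIf isValley d u c ≡ u ∷ []
  one-duc = centreIf-true isValley d u c (isValley-true u<d u<c)
  none-ucz : centreIf isValley u c z ≡ []
  none-ucz = centreIf-false isValley u c z (isValley-falseˡ z (<-asym u<c))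
  inner-after : centres isValley (v ∷ K ++ u ∷ []) ≡ centres isValley (u ∷ K ++ c ∷ [])
  inner-after = centres-cong-ends isValley v u K w K' K0 d u c K-head K-last (proj₂ (neighbourˡ-below v<w u<w)) (proj₂ (neighbourʳ-below u<d c<d))
  block-before : centreIf isValley v u w ++ centres isValley (u ∷ K ++ c ∷ []) ++ centreIf isValley d c z ≡ centres isValley (u ∷ K ++ c ∷ []) ++ c ∷ []
  block-before rewrite none-vuw | one-dcz = refl
  block-after : centres isValley (v ∷ K ++ u ∷ []) ++ centreIf isValley d u c ++ centreIf isValley u c z ≡ centres isValley (u ∷ K ++ c ∷ []) ++ u ∷ []
  block-after rewrite one-duc | none-ucz = cong (_++ u ∷ []) inner-after

valleys-moveLeft : ∀ P dd u K c K' K0 v z R → K ≡ c ∷ K' → K ≡ K0 ++ v ∷ [] →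
          c < dd → u < dd → c < u → v < u → u < z →
          centres isValley (P ++ dd ∷ u ∷ K ++ z ∷ R) ≡ centres isValley (P ++ dd ∷ K ++ u ∷ z ∷ R)
valleys-moveLeft P dd u K c K' K0 v z R K-head K-last c<dd u<dd c<u v<u u<z =
  trans Scan.centres-after (trans (++-cong₃ (sym prefix) block-after suffix-after) (sym Scan.centres-before))
  where
  module Scan = CentresLeft isValley P dd u K c K' K0 v z R K-head K-last
  v<z : v < z
  v<z = <-trans v<u u<z
  prefix : centres isValley (P ++ dd ∷ c ∷ []) ≡ centres isValley (P ++ dd ∷ u ∷ [])
  prefix = centres-cong-last isValley P dd c u (proj₂ (neighbourʳ-below c<dd u<dd))
  suffix-after : centres isValley (v ∷ z ∷ R) ≡ centres isValley (u ∷ z ∷ R)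
  suffix-after = centres-cong-head isValley v u z R (proj₂ (neighbourˡ-below v<z u<z))
  none-vuz : centreIf isValley v u z ≡ []
  none-vuz = centreIf-false isValley v u z (isValley-falseˡ z (<-asym v<u))
  none-duc : centreIf isValley dd u c ≡ []
  none-duc = centreIf-false isValley dd u c (isValley-falseʳ dd (<-asym c<u))
  inner-after : centres isValley (u ∷ K ++ z ∷ []) ≡ centres isValley (dd ∷ K ++ u ∷ [])
  inner-after = centres-cong-ends isValley u dd K c K' K0 v z u K-head K-last (proj₂ (neighbourˡ-above c<u c<dd)) (proj₂ (neighbourʳ-above v<z v<u))
  block-after : centreIf isValley dd u c ++ centres isValley (u ∷ K ++ z ∷ []) ≡ centres isValley (dd ∷ K ++ u ∷ []) ++ centreIf isValley v u z
  block-after rewrite none-vuz | none-duc = trans inner-after (sym (++-identityʳ _))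

-- Positions, reversals and moves in lists

Distinct : List ℕ → Set
Distinct [] = ⊤
Distinct (x ∷ l) = (x ∉ l) × Distinct l

Distinct-∉ : ∀ L x M → Distinct (L ++ x ∷ M) → (x ∉ L) × (x ∉ M)
Distinct-∉ [] x M (n , _) = (λ ()) , n
Distinct-∉ (y ∷ L) x M (n , d) with Distinct-∉ L x M d
... | (a , b) = (λ { (here refl) → n (∈-++⁺ʳ L (here refl)) ; (there p) → a p }) , b

≡ᵇ-refl : ∀ x → (x ≡ᵇ x) ≡ true
≡ᵇ-refl zero = refl
≡ᵇ-refl (suc x) = ≡ᵇ-refl x

≢⇒≡ᵇ-false : ∀ x y → ¬ x ≡ y → (x ≡ᵇ y) ≡ false
≢⇒≡ᵇ-false zero zero n = ⊥-elim (n refl)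
≢⇒≡ᵇ-false zero (suc y) n = refl
≢⇒≡ᵇ-false (suc x) zero n = refl
≢⇒≡ᵇ-false (suc x) (suc y) n = ≢⇒≡ᵇ-false x y (λ e → n (cong suc e))

indexOf-head : ∀ x M → indexOf x (x ∷ M) ≡ 0
indexOf-head x M rewrite ≡ᵇ-refl x = refl

indexOf-tail : ∀ x y M → ¬ x ≡ y → indexOf x (y ∷ M) ≡ suc (indexOf x M)
indexOf-tail x y M n rewrite ≢⇒≡ᵇ-false x y n = refl

indexOf-++ : ∀ L x M → x ∉ L → indexOf x (L ++ x ∷ M) ≡ length L
indexOf-++ [] x M n = indexOf-head x M
indexOf-++ (y ∷ L) x M n = trans (indexOf-tail x y (L ++ x ∷ M) (λ e → n (here e))) (cong suc (indexOf-++ L x M (λ p → n (there p))))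

take-length-++ : ∀ (X W : List ℕ) k → take (length X + k) (X ++ W) ≡ X ++ take k W
take-length-++ [] W k = refl
take-length-++ (x ∷ X) W k = cong (x ∷_) (take-length-++ X W k)

drop-length-++ : ∀ (X W : List ℕ) k → drop (length X + k) (X ++ W) ≡ drop k W
drop-length-++ [] W k = refl
drop-length-++ (x ∷ X) W k = drop-length-++ X W k

ρ-++ : ∀ w1 w2 X Y Z → indexOf w1 (X ++ Y ++ Z) ≡ length X → suc (indexOf w2 (X ++ Y ++ Z)) ≡ length X + length Y →
        ρ w1 w2 (X ++ Y ++ Z) ≡ X ++ reverse Y ++ Z
ρ-++ w1 w2 X Y Z h1 h2 rewrite h1 | h2 =
  cong₂ _++_ t1 (cong₂ _++_ (cong reverse t2) t3)
  where
  t1 : take (length X) (X ++ Y ++ Z) ≡ X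
  t1 = trans (cong (λ k → take k (X ++ Y ++ Z)) (sym (+-identityʳ (length X)))) (trans (take-length-++ X (Y ++ Z) 0) (++-identityʳ X))
  t2 : drop (length X) (take (length X + length Y) (X ++ Y ++ Z)) ≡ Y
  t2 = trans (cong (drop (length X)) (take-length-++ X (Y ++ Z) (length Y)))
        (trans (cong (λ k → drop k (X ++ take (length Y) (Y ++ Z))) (sym (+-identityʳ (length X))))
         (trans (drop-length-++ X (take (length Y) (Y ++ Z)) 0)
          (trans (cong (λ k → take k (Y ++ Z)) (sym (+-identityʳ (length Y)))) (trans (take-length-++ Y Z 0) (++-identityʳ Y)))))
  t3 : drop (length X + length Y) (X ++ Y ++ Z) ≡ Z
  t3 = trans (drop-length-++ X (Y ++ Z) (length Y)) (trans (cong (λ k → drop k (Y ++ Z)) (sym (+-identityʳ (length Y)))) (drop-length-++ Y Z 0))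

ρ-single : ∀ w X Z → w ∉ X → ρ w w (X ++ w ∷ Z) ≡ X ++ w ∷ Z
ρ-single w X Z n = trans (ρ-++ w w X (w ∷ []) Z (indexOf-++ X w Z n)
  (trans (cong suc (indexOf-++ X w Z n)) (sym (+-comm (length X) 1)))) refl

ρ-segment : ∀ w1 w2 X Y0 Z → w1 ∉ X → w2 ∉ X ++ w1 ∷ Y0 →
         ρ w1 w2 (X ++ w1 ∷ Y0 ++ w2 ∷ Z) ≡ X ++ w2 ∷ reverse Y0 ++ w1 ∷ Z
ρ-segment w1 w2 X Y0 Z n1 n2 =
  begin
    ρ w1 w2 (X ++ w1 ∷ Y0 ++ w2 ∷ Z)
  ≡⟨ cong (ρ w1 w2) eq1 ⟩
    ρ w1 w2 (X ++ (w1 ∷ Y0 ++ w2 ∷ []) ++ Z)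
  ≡⟨ ρ-++ w1 w2 X (w1 ∷ Y0 ++ w2 ∷ []) Z (trans (cong (indexOf w1) (sym eq1)) (indexOf-++ X w1 _ n1)) i2 ⟩
    X ++ reverse (w1 ∷ Y0 ++ w2 ∷ []) ++ Z
  ≡⟨ cong (λ t → X ++ t ++ Z) (reverse-∷-∷ʳ w2 Y0 w1) ⟩
    X ++ (w2 ∷ reverse Y0 ++ w1 ∷ []) ++ Z
  ≡⟨ cong (λ t → X ++ w2 ∷ t) (++-assoc (reverse Y0) (w1 ∷ []) Z) ⟩
    X ++ w2 ∷ reverse Y0 ++ w1 ∷ Z
  ∎
  where
  open ≡-Reasoning
  eq1 : X ++ w1 ∷ Y0 ++ w2 ∷ Z ≡ X ++ (w1 ∷ Y0 ++ w2 ∷ []) ++ Z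
  eq1 = cong (λ t → X ++ w1 ∷ t) (sym (++-assoc Y0 (w2 ∷ []) Z))
  eq2 : X ++ (w1 ∷ Y0 ++ w2 ∷ []) ++ Z ≡ (X ++ w1 ∷ Y0) ++ w2 ∷ Z
  eq2 = trans (sym eq1) (sym (++-assoc X (w1 ∷ Y0) (w2 ∷ Z)))
  i2 : suc (indexOf w2 (X ++ (w1 ∷ Y0 ++ w2 ∷ []) ++ Z)) ≡ length X + length (w1 ∷ Y0 ++ w2 ∷ [])
  i2 = trans (cong (λ t → suc (indexOf w2 t)) eq2)
       (trans (cong suc (indexOf-++ (X ++ w1 ∷ Y0) w2 Z n2))
        (trans (cong suc (length-++ X))
         (trans (sym (+-suc (length X) (suc (length Y0))))
          (cong (λ k → length X + suc k) (trans (+-comm 1 (length Y0)) (sym (length-++ Y0)))))))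

filter-≢-∉ : ∀ u L → u ∉ L → filter (λ x → ¬? (x ≟ u)) L ≡ L
filter-≢-∉ u [] n = refl
filter-≢-∉ u (x ∷ L) n = trans (filter-accept (λ x → ¬? (x ≟ u)) (λ e → n (here (sym e)))) (cong (x ∷_) (filter-≢-∉ u L (λ p → n (there p))))

filter-≢-middle : ∀ u L M → u ∉ L → u ∉ M → filter (λ x → ¬? (x ≟ u)) (L ++ u ∷ M) ≡ L ++ M
filter-≢-middle u [] M n1 n2 = trans (filter-reject (λ x → ¬? (x ≟ u)) (λ ne → ne refl)) (filter-≢-∉ u M n2)
filter-≢-middle u (x ∷ L) M n1 n2 = trans (filter-accept (λ x → ¬? (x ≟ u)) (λ e → n1 (here (sym e)))) (cong (x ∷_) (filter-≢-middle u L M (λ p → n1 (there p)) n2))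

insertBefore-++ : ∀ u t X Y → t ∉ X → insertBefore u t (X ++ t ∷ Y) ≡ X ++ u ∷ t ∷ Y
insertBefore-++ u t [] Y n rewrite ≡ᵇ-refl t = refl
insertBefore-++ u t (x ∷ X) Y n rewrite ≢⇒≡ᵇ-false x t (λ e → n (here (sym e))) = cong (x ∷_) (insertBefore-++ u t X Y (λ p → n (there p)))

moveBefore-middle : ∀ u t L M X Y → u ∉ L → u ∉ M → L ++ M ≡ X ++ t ∷ Y → t ∉ X → moveBefore u t (L ++ u ∷ M) ≡ X ++ u ∷ t ∷ Y
moveBefore-middle u t L M X Y n1 n2 e t∉X = trans (cong (insertBefore u t) (trans (filter-≢-middle u L M n1 n2) e)) (insertBefore-++ u t X Y t∉X)

∉-remove : ∀ {x : ℕ} L y M → x ∉ L ++ y ∷ M → x ∉ L ++ M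
∉-remove L y M n p with ∈-++⁻ L p
... | inj₁ q = n (∈-++⁺ˡ q)
... | inj₂ q = n (∈-++⁺ʳ L (there q))

∉-++ˡ : ∀ {x : ℕ} L M → x ∉ L ++ M → x ∉ L
∉-++ˡ L M n p = n (∈-++⁺ˡ p)

∉-∷ʳ : ∀ {x : ℕ} L y → x ∉ L → ¬ x ≡ y → x ∉ L ++ y ∷ []
∉-∷ʳ L y n ne p with ∈-++⁻ L p
... | inj₁ q = n q
... | inj₂ (here e) = ne e

∈-middle : ∀ {x : ℕ} L M → x ∈ L ++ x ∷ M
∈-middle L M = ∈-++⁺ʳ L (here refl)

peaks-↭-reversed : ∀ {E Em E''} → (S : PeakSplit E Em E'') → centres isPeak E ↭ centres isPeak Em
peaks-↭-reversed S rewrite PeakSplit.hE S | PeakSplit.hEm S = ++⁺ˡ (PeakSplit.A S) (++⁺ʳ (PeakSplit.C S) (↭-sym (↭-reverse (PeakSplit.I S))))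

peaks-reversed-↭ : ∀ {E Em E''} → (S : PeakSplit E Em E'') → centres isPeak Em ↭ centres isPeak E''
peaks-reversed-↭ S rewrite PeakSplit.hE'' S | PeakSplit.hEm S = ++⁺ˡ (PeakSplit.A S) (++⁺ʳ (PeakSplit.C S) (↭-reverse (PeakSplit.I S)))

balanced-from-↭ : ∀ π w1 w2 → centres isPeak (ext π) ↭ centres isPeak (ext (ρ w1 w2 π)) → Balanced π w1 w2
balanced-from-↭ π w1 w2 p x = mk⇔ (λ q → subst (x ∈_) (sym (peaks≡centres (ext (ρ w1 w2 π)))) (∈-resp-↭ p (subst (x ∈_) (peaks≡centres (ext π)) q)))
                          (λ q → subst (x ∈_) (sym (peaks≡centres (ext π))) (∈-resp-↭ (↭-sym p) (subst (x ∈_) (peaks≡centres (ext (ρ w1 w2 π))) q)))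

record TwoReversals (π π'' : List ℕ) : Set where
  field
    w₁ w₂ w₃ w₄ : ℕ
    valid₁ : ValidRev π w₁ w₂
    balanced₁ : Balanced π w₁ w₂
    valid₂ : ValidRev (ρ w₁ w₂ π) w₃ w₄
    balanced₂ : Balanced (ρ w₁ w₂ π) w₃ w₄
    result : ρ w₃ w₄ (ρ w₁ w₂ π) ≡ π''

twoReversals-from-split : ∀ {π π'' E Em E''} w₁ w₂ w₃ w₄ → PeakSplit E Em E'' →
  ext π ≡ E → ext (ρ w₁ w₂ π) ≡ Em → ext π'' ≡ E'' → ρ w₃ w₄ (ρ w₁ w₂ π) ≡ π'' →
  ValidRev π w₁ w₂ → ValidRev (ρ w₁ w₂ π) w₃ w₄ → TwoReversals π π''
twoReversals-from-split {π} w₁ w₂ w₃ w₄ S eE eEm eE'' ρρπ≡ valid₁ valid₂ = record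
  { w₁ = w₁ ; w₂ = w₂ ; w₃ = w₃ ; w₄ = w₄ ; valid₁ = valid₁ ; valid₂ = valid₂ ; result = ρρπ≡
  ; balanced₁ = balanced-from-↭ π w₁ w₂
      (subst₂ _↭_ (sym (cong (centres isPeak) eE)) (sym (cong (centres isPeak) eEm)) (peaks-↭-reversed S))
  ; balanced₂ = balanced-from-↭ (ρ w₁ w₂ π) w₃ w₄
      (subst₂ _↭_ (sym (cong (centres isPeak) eEm)) (sym (cong (centres isPeak) (trans (cong ext ρρπ≡) eE''))) (peaks-reversed-↭ S)) }

ext-++ : ∀ π X T → π ≡ X ++ T → ext π ≡ (suc (length π) ∷ X) ++ T ++ suc (suc (length π)) ∷ []
ext-++ π X T e = cong (suc (length π) ∷_) (trans (cong (_++ _) e) (++-assoc X T _))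

length-move : ∀ (u : ℕ) K T → length (u ∷ K ++ T) ≡ length (K ++ u ∷ T)
length-move u [] T = refl
length-move u (k ∷ K) T = cong suc (length-move u K T)

length-reverse-++ : ∀ (K T : List ℕ) → length (reverse K ++ T) ≡ length (K ++ T)
length-reverse-++ K T = trans (length-++ (reverse K)) (trans (cong (_+ length T) (length-reverse K)) (sym (length-++ K)))

length-++-cong : ∀ (A T T' : List ℕ) → length T ≡ length T' → length (A ++ T) ≡ length (A ++ T')
length-++-cong A T T' e = trans (length-++ A) (trans (cong (length A +_) e) (sym (length-++ A)))

ext-shape : ∀ π' n0 A T T' → length π' ≡ n0 → π' ≡ A ++ T → T ++ suc (suc n0) ∷ [] ≡ T' → ext π' ≡ (suc n0 ∷ A) ++ T'
ext-shape π' n0 A T T' refl e1 e2 = trans (ext-++ π' A T e1) (cong (λ t → (suc n0 ∷ A) ++ t) e2)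

++-∷⇒∷ʳ-++ : ∀ (A : List ℕ) v T → A ++ v ∷ T ≡ (A ++ v ∷ []) ++ T
++-∷⇒∷ʳ-++ A v T = sym (++-assoc A (v ∷ []) T)

∉-++-∷-reverse : ∀ {x : ℕ} X d L → x ∉ X → ¬ x ≡ d → x ∉ L → x ∉ X ++ d ∷ reverse L
∉-++-∷-reverse X d L n1 n2 x∉L p with ∈-++⁻ X p
... | inj₁ q = n1 q
... | inj₂ (here e) = n2 e
... | inj₂ (there q) = x∉L (reverse⁻ q)

-- u moves right across the block K = w … d of π = A v u K c B, landing in front of c.
module MoveRight (π A : List ℕ) (v u : ℕ) (K : List ℕ) (w : ℕ) (K' K0 : List ℕ) (d c : ℕ) (B : List ℕ) (z : ℕ) (R : List ℕ)
  (eπ : π ≡ A ++ v ∷ u ∷ K ++ c ∷ B) (K-head : K ≡ w ∷ K') (K-last : K ≡ K0 ++ d ∷ [])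
  (eB : B ++ suc (suc (length π)) ∷ [] ≡ z ∷ R) (dπ : Distinct π)
  (v<u : v < u) (u<w : u < w) (u<d : u < d) (c<d : c < d) (cc : c < u ⊎ c < z) where

  N1 : ℕ
  N1 = suc (length π)
  N2 : ℕ
  N2 = suc N1
  X : List ℕ
  X = A ++ v ∷ []
  π'' : List ℕ
  π'' = A ++ v ∷ K ++ u ∷ c ∷ B
  P : List ℕ
  P = N1 ∷ A

  π≡₀ : π ≡ X ++ u ∷ K0 ++ d ∷ c ∷ B
  π≡₀ = trans eπ (trans (++-∷⇒∷ʳ-++ A v (u ∷ K ++ c ∷ B)) (cong (λ t → X ++ u ∷ t) (trans (cong (_++ c ∷ B) K-last) (++-assoc K0 (d ∷ []) (c ∷ B)))))

  eπ3 : π ≡ (X ++ u ∷ K0) ++ d ∷ c ∷ B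
  eπ3 = trans π≡₀ (sym (++-assoc X (u ∷ K0) (d ∷ c ∷ B)))

  u∉X : u ∉ X
  u∉X = proj₁ (Distinct-∉ X u (K0 ++ d ∷ c ∷ B) (subst Distinct π≡₀ dπ))
  u∉rest : u ∉ K0 ++ d ∷ c ∷ B
  u∉rest = proj₂ (Distinct-∉ X u (K0 ++ d ∷ c ∷ B) (subst Distinct π≡₀ dπ))
  d∉front : d ∉ X ++ u ∷ K0
  d∉front = proj₁ (Distinct-∉ (X ++ u ∷ K0) d (c ∷ B) (subst Distinct eπ3 dπ))
  d∉X : d ∉ X
  d∉X = ∉-++ˡ X (u ∷ K0) d∉front

  length-after : length π'' ≡ length π
  length-after rewrite eπ = length-++-cong A (v ∷ K ++ u ∷ c ∷ B) (v ∷ u ∷ K ++ c ∷ B) (cong suc (sym (length-move u K (c ∷ B))))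

  ext-before : ext π ≡ P ++ v ∷ u ∷ K ++ c ∷ z ∷ R
  ext-before = ext-shape π (length π) A (v ∷ u ∷ K ++ c ∷ B) _ refl eπ (cong (λ t → v ∷ u ∷ t) (trans (++-assoc K (c ∷ B) _) (cong (λ t → K ++ c ∷ t) eB)))

  ext-after : ext π'' ≡ P ++ v ∷ K ++ u ∷ c ∷ z ∷ R
  ext-after = ext-shape π'' (length π) A (v ∷ K ++ u ∷ c ∷ B) _ length-after refl (cong (v ∷_) (trans (++-assoc K (u ∷ c ∷ B) _) (cong (λ t → K ++ u ∷ c ∷ t) eB)))

  mid : List ℕ
  mid = ρ u d π

  revK1 : reverse K ≡ d ∷ reverse K0
  revK1 rewrite K-last = reverse-++ K0 (d ∷ [])

  mid≡₀ : mid ≡ X ++ d ∷ reverse K0 ++ u ∷ c ∷ B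
  mid≡₀ = trans (cong (ρ u d) π≡₀) (ρ-segment u d X K0 (c ∷ B) u∉X d∉front)

  mid≡′ : mid ≡ A ++ v ∷ reverse K ++ u ∷ c ∷ B
  mid≡′ = trans mid≡₀ (trans (sym (++-∷⇒∷ʳ-++ A v _)) (cong (λ t → A ++ v ∷ t ++ u ∷ c ∷ B) (sym revK1)))

  length-mid : length mid ≡ length π
  length-mid = trans (cong length mid≡′) (trans (length-++-cong A (v ∷ reverse K ++ u ∷ c ∷ B) (v ∷ K ++ u ∷ c ∷ B) (cong suc (length-reverse-++ K (u ∷ c ∷ B)))) length-after)

  ext-between : ext mid ≡ P ++ v ∷ reverse K ++ u ∷ c ∷ z ∷ R
  ext-between = ext-shape mid (length π) A (v ∷ reverse K ++ u ∷ c ∷ B) _ length-mid mid≡′ (cong (v ∷_) (trans (++-assoc (reverse K) (u ∷ c ∷ B) _) (cong (λ t → reverse K ++ u ∷ c ∷ t) eB)))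

  peakSplit : PeakSplit (P ++ v ∷ u ∷ K ++ c ∷ z ∷ R) (P ++ v ∷ reverse K ++ u ∷ c ∷ z ∷ R) (P ++ v ∷ K ++ u ∷ c ∷ z ∷ R)
  peakSplit = peaks-moveRight P v u K w K' K0 d c z R K-head K-last v<u u<w u<d c<d cc

  record Second : Set where
    field
      result : ρ d w mid ≡ π''
      valid : ValidRev mid d w

  second-from-view : ∀ K0' → K ≡ K0' ++ d ∷ [] → mid ≡ X ++ d ∷ reverse K0' ++ u ∷ c ∷ B → π ≡ X ++ u ∷ K0' ++ d ∷ c ∷ B → Second
  second-from-view [] K-last′ mid≡₀ π≡₀ with ∷-injective (trans (sym K-head) K-last′)
  ... | refl , refl = record { result = trans (cong (ρ d d) mid≡₀) (trans (ρ-single d X (u ∷ c ∷ B) d∉X) (trans (sym (++-∷⇒∷ʳ-++ A v _)) (cong (λ t → A ++ v ∷ t ++ u ∷ c ∷ B) (sym K-last′))))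
                             ; valid = subst (λ m → ValidRev m d d) (sym mid≡₀) (∈-middle X _ , ∈-middle X _ , ≤-refl) }
  second-from-view (w0 ∷ K1) K-last′ mid≡₀ π≡₀ with ∷-injective (trans (sym K-head) K-last′)
  ... | refl , _ = record { result = trans (cong (ρ d w) mid≡″) (trans (ρ-segment d w X (reverse K1) (u ∷ c ∷ B) d∉X w∉front) second-lands)
                          ; valid = subst (λ m → ValidRev m d w) (sym mid≡″) (∈-middle X _ , ∈-++⁺ʳ X (there (∈-middle (reverse K1) _)) , ≤-trans (≤-reflexive (indexOf-++ X d _ d∉X)) d-before-w) }
    where
    mid≡″ : mid ≡ X ++ d ∷ reverse K1 ++ w ∷ u ∷ c ∷ B
    mid≡″ = trans mid≡₀ (cong (λ t → X ++ d ∷ t) (trans (cong (_++ u ∷ c ∷ B) (unfold-reverse w K1)) (++-assoc (reverse K1) (w ∷ []) (u ∷ c ∷ B))))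
    eπw : π ≡ (X ++ u ∷ []) ++ w ∷ (K1 ++ d ∷ c ∷ B)
    eπw = trans π≡₀ (sym (++-assoc X (u ∷ []) (w ∷ K1 ++ d ∷ c ∷ B)))
    dw : (w ∉ X ++ u ∷ []) × (w ∉ K1 ++ d ∷ c ∷ B)
    dw = Distinct-∉ (X ++ u ∷ []) w (K1 ++ d ∷ c ∷ B) (subst Distinct eπw dπ)
    w∉front : w ∉ X ++ d ∷ reverse K1
    w∉front = ∉-++-∷-reverse X d K1 (∉-++ˡ X (u ∷ []) (proj₁ dw)) (λ e → proj₂ dw (∈-++⁺ʳ K1 (here e))) (∉-++ˡ K1 (d ∷ c ∷ B) (proj₂ dw))
    d-before-w : length X ≤ indexOf w (X ++ d ∷ reverse K1 ++ w ∷ u ∷ c ∷ B)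
    d-before-w = subst (length X ≤_) (sym (trans (cong (indexOf w) (sym (++-assoc X (d ∷ reverse K1) (w ∷ u ∷ c ∷ B)))) (indexOf-++ (X ++ d ∷ reverse K1) w _ w∉front))) (≤-trans (m≤m+n (length X) _) (≤-reflexive (sym (length-++ X))))
    second-lands : X ++ w ∷ reverse (reverse K1) ++ d ∷ u ∷ c ∷ B ≡ π''
    second-lands = trans (sym (++-∷⇒∷ʳ-++ A v _)) (cong (λ t → A ++ v ∷ t) (trans (cong (λ t → w ∷ t ++ d ∷ u ∷ c ∷ B) (reverse-involutive K1)) (trans (cong (w ∷_) (sym (++-assoc K1 (d ∷ []) (u ∷ c ∷ B)))) (cong (_++ u ∷ c ∷ B) (sym K-last′)))))

  second : Second
  second = second-from-view K0 K-last mid≡₀ π≡₀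

  valid-first : ValidRev π u d
  valid-first = subst (u ∈_) (sym π≡₀) (∈-middle X _) , subst (d ∈_) (sym eπ3) (∈-middle (X ++ u ∷ K0) _)
         , subst₂ _≤_ (sym (trans (cong (indexOf u) π≡₀) (indexOf-++ X u _ u∉X))) (sym (trans (cong (indexOf d) eπ3) (indexOf-++ (X ++ u ∷ K0) d _ d∉front)))
                 (≤-trans (m≤m+n (length X) _) (≤-reflexive (sym (length-++ X))))

  reversals : TwoReversals π π''
  reversals = twoReversals-from-split u d d w peakSplit ext-before ext-between ext-after
    (Second.result second) valid-first (Second.valid second)

  π≡ : π ≡ X ++ u ∷ K ++ c ∷ B
  π≡ = trans eπ (++-∷⇒∷ʳ-++ A v _)
  u∉after : u ∉ K ++ c ∷ B
  u∉after = subst (λ t → u ∉ t) (sym (trans (cong (_++ c ∷ B) K-last) (++-assoc K0 (d ∷ []) (c ∷ B)))) u∉rest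
  π≡′ : π ≡ (X ++ u ∷ K) ++ c ∷ B
  π≡′ = trans π≡ (sym (++-assoc X (u ∷ K) (c ∷ B)))
  c∉front : c ∉ A ++ v ∷ K
  c∉front = subst (λ t → c ∉ t) (++-assoc A (v ∷ []) K) (∉-remove X u K (proj₁ (Distinct-∉ (X ++ u ∷ K) c B (subst Distinct π≡′ dπ))))
  moveBefore-result : moveBefore u c π ≡ π''
  moveBefore-result = trans (cong (moveBefore u c) π≡)
        (trans (moveBefore-middle u c X (K ++ c ∷ B) (A ++ v ∷ K) B u∉X u∉after
                 (trans (++-assoc A (v ∷ []) (K ++ c ∷ B)) (sym (++-assoc A (v ∷ K) (c ∷ B)))) c∉front)
         (++-assoc A (v ∷ K) (u ∷ c ∷ B)))

ext-shape′ : ∀ π' n0 A T T' P (dd : ℕ) → length π' ≡ n0 → π' ≡ A ++ T → T ++ suc (suc n0) ∷ [] ≡ T' →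
            suc n0 ∷ A ≡ P ++ dd ∷ [] → ext π' ≡ P ++ dd ∷ T'
ext-shape′ π' n0 A T T' P dd l e1 e2 e3 = trans (ext-shape π' n0 A T T' l e1 e2) (trans (cong (_++ T') e3) (++-assoc P (dd ∷ []) T'))

∉-∷ʳ-∷-reverse : ∀ {x : ℕ} A u v L → x ∉ A → ¬ x ≡ u → ¬ x ≡ v → x ∉ L → x ∉ (A ++ u ∷ []) ++ v ∷ reverse L
∉-∷ʳ-∷-reverse A u v L x∉A x≢u x≢v x∉L p with ∈-++⁻ (A ++ u ∷ []) p
... | inj₁ q = ∉-∷ʳ A u x∉A x≢u q
... | inj₂ (here e) = x≢v e
... | inj₂ (there q) = x∉L (reverse⁻ q)

-- u moves left across the block K = c … v of π = A K u B, landing in front of c;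
-- dd is the entry before c in ext π.
module MoveLeft (π A P : List ℕ) (dd c : ℕ) (K K' K0 : List ℕ) (v u : ℕ) (B : List ℕ) (z : ℕ) (R : List ℕ)
  (eπ : π ≡ A ++ c ∷ K' ++ u ∷ B) (K-head : K ≡ c ∷ K') (K-last : K ≡ K0 ++ v ∷ [])
  (eP : suc (length π) ∷ A ≡ P ++ dd ∷ [])
  (eB : B ++ suc (suc (length π)) ∷ [] ≡ z ∷ R) (dπ : Distinct π)
  (c<dd : c < dd) (u<dd : u < dd) (c<u : c < u) (v<u : v < u) (u<z : u < z) where

  π'' : List ℕ
  π'' = A ++ u ∷ K ++ B

  dc : (c ∉ A) × (c ∉ K' ++ u ∷ B)
  dc = Distinct-∉ A c (K' ++ u ∷ B) (subst Distinct eπ dπ)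
  c∉A : c ∉ A
  c∉A = proj₁ dc
  eπu : π ≡ (A ++ c ∷ K') ++ u ∷ B
  eπu = trans eπ (sym (++-assoc A (c ∷ K') (u ∷ B)))
  du : (u ∉ A ++ c ∷ K') × (u ∉ B)
  du = Distinct-∉ (A ++ c ∷ K') u B (subst Distinct eπu dπ)
  u∉front : u ∉ A ++ c ∷ K'
  u∉front = proj₁ du

  length-after : length π'' ≡ length π
  length-after rewrite eπ | K-head = length-++-cong A (u ∷ c ∷ K' ++ B) (c ∷ K' ++ u ∷ B) (cong suc (length-move u K' B))

  ext-before : ext π ≡ P ++ dd ∷ K ++ u ∷ z ∷ R
  ext-before = ext-shape′ π (length π) A (c ∷ K' ++ u ∷ B) _ P dd refl eπ
         (trans (cong (c ∷_) (trans (++-assoc K' (u ∷ B) _) (cong (λ t → K' ++ u ∷ t) eB))) (cong (_++ u ∷ z ∷ R) (sym K-head))) eP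

  ext-after : ext π'' ≡ P ++ dd ∷ u ∷ K ++ z ∷ R
  ext-after = ext-shape′ π'' (length π) A (u ∷ K ++ B) _ P dd length-after refl (cong (λ t → u ∷ t) (trans (++-assoc K B _) (cong (K ++_) eB))) eP

  mid : List ℕ
  mid = ρ c u π

  mid≡ : mid ≡ A ++ u ∷ reverse K' ++ c ∷ B
  mid≡ = trans (cong (ρ c u) eπ) (ρ-segment c u A K' B c∉A u∉front)

  revK2 : reverse K ≡ reverse K' ++ c ∷ []
  revK2 rewrite K-head = unfold-reverse c K'

  mid≡′ : mid ≡ A ++ u ∷ reverse K ++ B
  mid≡′ = trans mid≡ (cong (λ t → A ++ u ∷ t) (trans (sym (++-assoc (reverse K') (c ∷ []) B)) (cong (_++ B) (sym revK2))))

  length-mid : length mid ≡ length π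
  length-mid = trans (cong length mid≡′) (trans (length-++-cong A (u ∷ reverse K ++ B) (u ∷ K ++ B) (cong suc (length-reverse-++ K B))) length-after)

  ext-between : ext mid ≡ P ++ dd ∷ u ∷ reverse K ++ z ∷ R
  ext-between = ext-shape′ mid (length π) A (u ∷ reverse K ++ B) _ P dd length-mid mid≡′ (cong (u ∷_) (trans (++-assoc (reverse K) B _) (cong (reverse K ++_) eB))) eP

  peakSplit : PeakSplit (P ++ dd ∷ K ++ u ∷ z ∷ R) (P ++ dd ∷ u ∷ reverse K ++ z ∷ R) (P ++ dd ∷ u ∷ K ++ z ∷ R)
  peakSplit = peaks-moveLeft P dd u K c K' K0 v z R K-head K-last c<dd u<dd c<u v<u u<z

  record Second : Set where
    field
      result : ρ v c mid ≡ π''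
      valid : ValidRev mid v c

  second-from-view : ∀ K'' → Reverse.Reverse K'' → K' ≡ K'' → Second
  second-from-view .[] Reverse.[] refl with ∷ʳ-injective [] K0 (trans (sym K-head) K-last)
  ... | _ , refl = record { result = trans (cong (ρ v v) mid≡″) (trans (ρ-single v (A ++ u ∷ []) B (∉-∷ʳ A u c∉A (λ e → proj₂ dc (∈-++⁺ʳ K' (here e)))))
                                     (trans (++-assoc A (u ∷ []) (v ∷ B)) (cong (λ t → A ++ u ∷ t ++ B) (sym K-head))))
                           ; valid = subst (λ m → ValidRev m v v) (sym mid≡″) (∈-middle (A ++ u ∷ []) _ , ∈-middle (A ++ u ∷ []) _ , ≤-refl) }
    where
    mid≡″ : mid ≡ (A ++ u ∷ []) ++ v ∷ B
    mid≡″ = trans mid≡ (sym (++-assoc A (u ∷ []) (v ∷ B)))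
  second-from-view .(K1 ++ t ∷ []) (K1 ∶ _ ∶ʳ t) refl with ∷ʳ-injective (c ∷ K1) K0 (trans (sym K-head) K-last)
  ... | _ , refl = record { result = trans (cong (ρ v c) mid≡″) (trans (ρ-segment v c (A ++ u ∷ []) (reverse K1) B v∉front c∉front) second-lands)
                          ; valid = subst (λ m → ValidRev m v c) (sym mid≡″) (∈-middle (A ++ u ∷ []) _ , ∈-++⁺ʳ (A ++ u ∷ []) (there (∈-middle (reverse K1) _)) ,
                                   subst₂ _≤_ (sym (indexOf-++ (A ++ u ∷ []) v _ v∉front))
                                     (sym (trans (cong (indexOf c) (sym (++-assoc (A ++ u ∷ []) (v ∷ reverse K1) (c ∷ B)))) (indexOf-++ ((A ++ u ∷ []) ++ v ∷ reverse K1) c B c∉front)))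
                                     (≤-trans (m≤m+n (length (A ++ u ∷ [])) _) (≤-reflexive (sym (length-++ (A ++ u ∷ []))))) ) }
    where
    mid≡″ : mid ≡ (A ++ u ∷ []) ++ v ∷ reverse K1 ++ c ∷ B
    mid≡″ = trans mid≡ (trans (cong (λ t → A ++ u ∷ t ++ c ∷ B) (reverse-++ K1 (v ∷ []))) (sym (++-assoc A (u ∷ []) _)))
    eπv : π ≡ (A ++ c ∷ K1) ++ v ∷ u ∷ B
    eπv = trans eπ (trans (cong (λ t → A ++ c ∷ t) (++-assoc K1 (v ∷ []) (u ∷ B))) (sym (++-assoc A (c ∷ K1) (v ∷ u ∷ B))))
    dv : (v ∉ A ++ c ∷ K1) × (v ∉ u ∷ B)
    dv = Distinct-∉ (A ++ c ∷ K1) v (u ∷ B) (subst Distinct eπv dπ)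
    v∉front : v ∉ A ++ u ∷ []
    v∉front = ∉-∷ʳ A u (∉-++ˡ A (c ∷ K1) (proj₁ dv)) (λ e → proj₂ dv (here e))
    c∉rest : c ∉ K1 ++ v ∷ u ∷ B
    c∉rest = subst (λ t → c ∉ t) (++-assoc K1 (v ∷ []) (u ∷ B)) (proj₂ dc)
    c∉front : c ∉ (A ++ u ∷ []) ++ v ∷ reverse K1
    c∉front = ∉-∷ʳ-∷-reverse A u v K1 c∉A (λ e → c∉rest (∈-++⁺ʳ K1 (there (here e)))) (λ e → c∉rest (∈-++⁺ʳ K1 (here e))) (∉-++ˡ K1 _ c∉rest)
    second-lands : (A ++ u ∷ []) ++ c ∷ reverse (reverse K1) ++ v ∷ B ≡ π''
    second-lands = trans (++-assoc A (u ∷ []) _) (cong (λ s → A ++ u ∷ s) (trans (cong (c ∷_) (trans (cong (_++ t ∷ B) (reverse-involutive K1))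
            (sym (++-assoc K1 (t ∷ []) B)))) (cong (_++ B) (sym K-head))))

  second : Second
  second = second-from-view K' (reverseView K') refl

  valid-first : ValidRev π c u
  valid-first = subst (c ∈_) (sym eπ) (∈-middle A _) , subst (u ∈_) (sym eπu) (∈-middle (A ++ c ∷ K') _)
         , subst₂ _≤_ (sym (trans (cong (indexOf c) eπ) (indexOf-++ A c _ c∉A))) (sym (trans (cong (indexOf u) eπu) (indexOf-++ (A ++ c ∷ K') u _ u∉front)))
                 (≤-trans (m≤m+n (length A) _) (≤-reflexive (sym (length-++ A))))

  reversals : TwoReversals π π''
  reversals = twoReversals-from-split c u v c peakSplit ext-before ext-between ext-after
    (Second.result second) valid-first (Second.valid second)

  moveBefore-result : moveBefore u c π ≡ π''
  moveBefore-result = trans (cong (moveBefore u c) eπu)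
        (trans (moveBefore-middle u c (A ++ c ∷ K') B A (K' ++ B) u∉front (proj₂ du) (++-assoc A (c ∷ K') B) c∉A)
         (cong (λ t → A ++ u ∷ t ++ B) (sym K-head)))

-- Permutations, D-sets and cut points

Unique⇒Distinct : ∀ {l} → Unique l → Distinct l
Unique⇒Distinct AllPairs.[] = tt
Unique⇒Distinct (a AllPairs.∷ u) = All¬⇒¬Any a , Unique⇒Distinct u

Distinct-resp-↭ : ∀ {xs ys} → xs ↭ ys → Distinct xs → Distinct ys
Distinct-resp-↭ Perm.refl d = d
Distinct-resp-↭ (prep x p) (n , d) = (λ q → n (∈-resp-↭ (↭-sym p) q)) , Distinct-resp-↭ p d
Distinct-resp-↭ (swap x y p) (nx , ny , d) =
  (λ { (here e) → nx (here (sym e)) ; (there q) → ny (∈-resp-↭ (↭-sym p) q) })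
  , (λ q → nx (there (∈-resp-↭ (↭-sym p) q))) , Distinct-resp-↭ p d
Distinct-resp-↭ (Perm.trans p q) d = Distinct-resp-↭ q (Distinct-resp-↭ p d)

record PermutationFacts (n : ℕ) (π : List ℕ) : Set where
  field
    len : length π ≡ n
    dist : Distinct π
    bnd : ∀ x → x ∈ π → 0 < x × x ≤ n

permutationFacts : ∀ n π → π ↭ map suc (upTo n) → PermutationFacts n π
permutationFacts n π p = record
  { len = trans (↭-length p) (trans (length-map suc (upTo n)) (length-upTo n))
  ; dist = Distinct-resp-↭ (↭-sym p) (Unique⇒Distinct (UP.map⁺ suc-injective (UP.upTo⁺ n)))
  ; bnd = λ x q → bd (∈-map⁻ suc (∈-resp-↭ p q)) }
  where
  bd : ∀ {x} → ∃ (λ i → i ∈ upTo n × x ≡ suc i) → 0 < x × x ≤ n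
  bd (i , m , refl) = s≤s z≤n , ∈-upTo⁻ m

Distinct-∷ʳ : ∀ L (y : ℕ) → Distinct L → y ∉ L → Distinct (L ++ y ∷ [])
Distinct-∷ʳ [] y d n = (λ ()) , tt
Distinct-∷ʳ (x ∷ L) y (nx , d) n = (λ p → [ nx , (λ { (here e) → n (here (sym e)) }) ]′ (∈-++⁻ L p)) , Distinct-∷ʳ L y d (λ p → n (there p))

Distinct-ext : ∀ π → Distinct π → (∀ x → x ∈ π → x ≤ length π) → Distinct (ext π)
Distinct-ext π d b = (λ p → [ (λ q → <-irrefl refl (b _ q)) , (λ { (here e) → <-irrefl e (n<1+n _) }) ]′ (∈-++⁻ π p))
              , Distinct-∷ʳ π _ d (λ q → <-irrefl refl (<-trans (b _ q) (n<1+n _)))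

WellFormed-ext : ∀ x L y → x ∉ L → Distinct L → (∀ z → z ∈ L → z < y) → x < y → WellFormed (x ∷ L ++ y ∷ [])
WellFormed-ext x [] y n d b x<y = x<y
WellFormed-ext x (l ∷ []) y n d b x<y = (λ e → n (here e)) , b l (here refl)
WellFormed-ext x (l ∷ l' ∷ L) y n (nl , d) b x<y = (λ e → n (here e)) , WellFormed-ext l (l' ∷ L) y nl d (λ z p → b z (there p)) (b l (here refl))

nth-++ : ∀ L (x : ℕ) M d → nth (L ++ x ∷ M) (length L) d ≡ x
nth-++ [] x M d = refl
nth-++ (y ∷ L) x M d = nth-++ L x M d

nth-∈ : ∀ L j (d : ℕ) → nth L j d ∈ L ⊎ nth L j d ≡ d
nth-∈ [] j d = inj₂ refl
nth-∈ (x ∷ L) zero d = inj₁ (here refl)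
nth-∈ (x ∷ L) (suc j) d with nth-∈ L j d
... | inj₁ p = inj₁ (there p)
... | inj₂ e = inj₂ e

nth-index : ∀ V1 (c : ℕ) V3 j d → c ∉ V1 → c ∉ V3 → ¬ c ≡ d → nth (V1 ++ c ∷ V3) j d ≡ c → j ≡ length V1
nth-index [] c V3 zero d n1 c∉V3 nd e = refl
nth-index [] c V3 (suc j) d n1 c∉V3 nd e with nth-∈ V3 j d
... | inj₁ p = ⊥-elim (c∉V3 (subst (_∈ V3) e p))
... | inj₂ e' = ⊥-elim (nd (trans (sym e) e'))
nth-index (x ∷ V1) c V3 zero d n1 c∉V3 nd e = ⊥-elim (n1 (here (sym e)))
nth-index (x ∷ V1) c V3 (suc j) d n1 c∉V3 nd e = cong suc (nth-index V1 c V3 j d (λ p → n1 (there p)) c∉V3 nd e)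

∈-centreIf : ∀ f a b c {x : ℕ} → x ∈ centreIf f a b c → x ≡ b
∈-centreIf f a b c p with f a b c
∈-centreIf f a b c (here e) | true = e

centres-⊆-tail : ∀ f a L {x : ℕ} → x ∈ centres f (a ∷ L) → x ∈ L
centres-⊆-tail f a (b ∷ c ∷ r) p = [ (λ q → here (∈-centreIf f a b c q)) , (λ q → there (centres-⊆-tail f b (c ∷ r) q)) ]′ (∈-++⁻ (centreIf f a b c) p)

centres-⊆-init : ∀ f L (y : ℕ) {x} → x ∈ centres f (L ++ y ∷ []) → x ∈ L
centres-⊆-init f (a ∷ b ∷ []) y p with ∈-++⁻ (centreIf f a b y) p
... | inj₁ q = there (here (∈-centreIf f a b y q))
centres-⊆-init f (a ∷ b ∷ c ∷ L) y p = [ (λ q → there (here (∈-centreIf f a b c q))) , (λ q → there (centres-⊆-init f (b ∷ c ∷ L) y q)) ]′ (∈-++⁻ (centreIf f a b c) p)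

indexOf-< : ∀ {y : ℕ} L M → y ∈ L → indexOf y (L ++ M) < length L
indexOf-< {y} (h ∷ L) M (here refl) = subst (_< suc (length L)) (sym (indexOf-head h (L ++ M))) (s≤s z≤n)
indexOf-< {y} (h ∷ L) M (there p) with y ≟ h
... | yes refl = subst (_< suc (length L)) (sym (indexOf-head h (L ++ M))) (s≤s z≤n)
... | no ne = subst (_< suc (length L)) (sym (indexOf-tail y h (L ++ M) ne)) (s≤s (indexOf-< L M p))

∈-take-drop : ∀ l s m {x : ℕ} → x ∈ l → s ≤ indexOf x l → indexOf x l < s + m → x ∈ take m (drop s l)
∈-take-drop (h ∷ l) zero zero p le ()
∈-take-drop (h ∷ l) zero (suc m) {x} (here refl) le lt = here refl
∈-take-drop (h ∷ l) zero (suc m) {x} (there p) le lt with x ≟ h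
... | yes refl = here refl
... | no ne = there (∈-take-drop l zero m p z≤n (≤-pred (subst (_< suc m) (indexOf-tail x h l ne) lt)))
∈-take-drop (h ∷ l) (suc s) m {x} p le lt with x ≟ h
... | yes refl = ⊥-elim (n≮0 (subst (suc s ≤_) (indexOf-head h l) le))
... | no ne with p
...   | here e = ⊥-elim (ne e)
...   | there p' = ∈-take-drop l s m p' (≤-pred (subst (suc s ≤_) (indexOf-tail x h l ne) le)) (≤-pred (subst (_< suc s + m) (indexOf-tail x h l ne) lt))

indexOf-≥ : ∀ L M {t : ℕ} → t ∉ L → length L ≤ indexOf t (L ++ M)
indexOf-≥ [] M n = z≤n
indexOf-≥ (h ∷ L) M {t} n = subst (suc (length L) ≤_) (sym (indexOf-tail t h (L ++ M) (λ e → n (here e)))) (s≤s (indexOf-≥ L M (λ p → n (there p))))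

∈-between : ∀ l L1 (x : ℕ) L2 y t → l ≡ L1 ++ x ∷ L2 → y ∈ L1 → x ∉ L1 → t ∉ L1 ++ x ∷ [] →
          x ∈ take (indexOf t l ∸ suc (indexOf y l)) (drop (suc (indexOf y l)) l)
∈-between l L1 x L2 y t el yi xn tn = ∈-take-drop l (suc iy) (it ∸ suc iy) xin le1 lt1
  where
  iy : ℕ
  iy = indexOf y l
  it : ℕ
  it = indexOf t l
  ix : indexOf x l ≡ length L1
  ix = trans (cong (indexOf x) el) (indexOf-++ L1 x L2 xn)
  xin : x ∈ l
  xin = subst (x ∈_) (sym el) (∈-middle L1 L2)
  iyl : iy < length L1
  iyl = subst (_< length L1) (cong (indexOf y) (sym el)) (indexOf-< L1 (x ∷ L2) yi)
  itg : suc (length L1) ≤ it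
  itg = subst (suc (length L1) ≤_) (cong (indexOf t) (trans (++-assoc L1 (x ∷ []) L2) (sym el)))
          (subst (_≤ indexOf t ((L1 ++ x ∷ []) ++ L2)) (trans (length-++ L1) (+-comm (length L1) 1)) (indexOf-≥ (L1 ++ x ∷ []) L2 tn))
  le1 : suc iy ≤ indexOf x l
  le1 = subst (suc iy ≤_) (sym ix) iyl
  lt1 : indexOf x l < suc iy + (it ∸ suc iy)
  lt1 = subst (indexOf x l <_) (sym (m+[n∸m]≡n (≤-trans (s≤s (<⇒≤ iyl)) itg))) (subst (_< it) (sym ix) itg)

between-++ : ∀ e E1 (y : ℕ) D x E2 → e ≡ E1 ++ y ∷ D ++ x ∷ E2 → y ∉ E1 → x ∉ E1 ++ y ∷ D →
           take (indexOf x e ∸ suc (indexOf y e)) (drop (suc (indexOf y e)) e) ≡ D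
between-++ e E1 y D x E2 ee yn xn = trans (cong₂ (λ a b → take (a ∸ suc b) (drop (suc b) e)) ixe iye) body
  where
  iye : indexOf y e ≡ length E1
  iye = trans (cong (indexOf y) ee) (indexOf-++ E1 y _ yn)
  e2 : e ≡ (E1 ++ y ∷ D) ++ x ∷ E2
  e2 = trans ee (sym (++-assoc E1 (y ∷ D) (x ∷ E2)))
  ixe : indexOf x e ≡ length E1 + suc (length D)
  ixe = trans (cong (indexOf x) e2) (trans (indexOf-++ (E1 ++ y ∷ D) x E2 xn) (length-++ E1))
  e3 : e ≡ (E1 ++ y ∷ []) ++ D ++ x ∷ E2
  e3 = trans ee (sym (++-assoc E1 (y ∷ []) (D ++ x ∷ E2)))
  dr : drop (suc (length E1)) e ≡ D ++ x ∷ E2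
  dr = trans (cong₂ drop (trans (trans (+-comm 1 (length E1)) (sym (length-++ E1))) (sym (+-identityʳ _))) e3) (drop-length-++ (E1 ++ y ∷ []) (D ++ x ∷ E2) 0)
  ar : length E1 + suc (length D) ∸ suc (length E1) ≡ length D
  ar = trans (cong (_∸ suc (length E1)) (+-suc (length E1) (length D))) (m+n∸m≡n (length E1) (length D))
  body : take (length E1 + suc (length D) ∸ suc (length E1)) (drop (suc (length E1)) e) ≡ D
  body rewrite ar | dr = trans (cong (λ k → take k (D ++ x ∷ E2)) (sym (+-identityʳ (length D)))) (trans (take-length-++ D (x ∷ E2) 0) (++-identityʳ D))

Descending-below : ∀ h L → Descending (h ∷ L) → ∀ z → z ∈ L → z < h
Descending-below h (a ∷ L) (a<h , d) z (here refl) = a<h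
Descending-below h (a ∷ L) (a<h , d) z (there p) = <-trans (Descending-below a L d z p) a<h

foldr-⊔-≤ : ∀ l (h : ℕ) → (∀ z → z ∈ l → z ≤ h) → foldr _⊔_ 0 l ≤ h
foldr-⊔-≤ [] h b = z≤n
foldr-⊔-≤ (x ∷ l) h b = ⊔-lub (b x (here refl)) (foldr-⊔-≤ l h (λ z p → b z (there p)))

-- Where u falls in the descent y D x: between adjacent entries d > u > c, where c, the
-- largest entry of x ∷ D below u, is the value computed by `cutD`.
record CutPoint (u y : ℕ) (D : List ℕ) (x : ℕ) : Set where
  field
    R1 : List ℕ
    d c : ℕ
    R2 : List ℕ
    eq : y ∷ D ++ x ∷ [] ≡ R1 ++ d ∷ c ∷ R2
    u<d : u < d
    c<u : c < u
    c-is-max : foldr _⊔_ 0 (filter (λ e → e <? u) (x ∷ D)) ≡ c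

cutPoint : ∀ u y D x → Descending (y ∷ D ++ x ∷ []) → u < y → x < u → u ∉ D → CutPoint u y D x
cutPoint u y [] x dec u<y x<u n = record { R1 = [] ; d = y ; c = x ; R2 = [] ; eq = refl ; u<d = u<y ; c<u = x<u
  ; c-is-max = trans (cong (foldr _⊔_ 0) (filter-accept (λ e → e <? u) x<u)) (⊔-identityʳ x) }
cutPoint u y (h ∷ D) x (h<y , dec) u<y x<u n with <-cmp h u
... | tri≈ _ e _ = ⊥-elim (n (here (sym e)))
... | tri< h<u _ _ = record { R1 = [] ; d = y ; c = h ; R2 = D ++ x ∷ [] ; eq = refl ; u<d = u<y ; c<u = h<u
  ; c-is-max = trans (cong (foldr _⊔_ 0) (trans (filter-accept P? x<u) (cong (x ∷_) (filter-accept P? h<u))))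
          (trans (cong (x ⊔_) (m≥n⇒m⊔n≡m (foldr-⊔-≤ (filter P? D) h (λ z p → <⇒≤ (Descending-below h (D ++ x ∷ []) dec z (∈-++⁺ˡ (proj₁ (∈-filter⁻ P? {xs = D} p))))))))
            (m≤n⇒m⊔n≡n (<⇒≤ (Descending-below h (D ++ x ∷ []) dec x (∈-++⁺ʳ D (here refl)))))) }
  where
  P? : ∀ e → Dec (e < u)
  P? = λ e → e <? u
... | tri> _ _ u<h = record { R1 = y ∷ CutPoint.R1 R ; d = CutPoint.d R ; c = CutPoint.c R ; R2 = CutPoint.R2 R ; eq = cong (y ∷_) (CutPoint.eq R)
  ; u<d = CutPoint.u<d R ; c<u = CutPoint.c<u R
  ; c-is-max = trans (cong (foldr _⊔_ 0) (trans (filter-accept P? x<u) (trans (cong (x ∷_) (filter-reject P? (<-asym u<h))) (sym (filter-accept P? x<u))))) (CutPoint.c-is-max R) }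
  where
  P? : ∀ e → Dec (e < u)
  P? = λ e → e <? u
  R : CutPoint u h D x
  R = cutPoint u h D x dec u<h x<u (λ p → n (there p))

nth-++-second : ∀ L (x y : ℕ) M d → nth (L ++ x ∷ y ∷ M) (suc (length L)) d ≡ y
nth-++-second [] x y M d = refl
nth-++-second (z ∷ L) x y M d = nth-++-second L x y M d

last-segment : ∀ X L Y (v : ℕ) → ¬ L ≡ [] → X ++ L ≡ Y ++ v ∷ [] → ∃ λ K0 → L ≡ K0 ++ v ∷ []
last-segment X L Y v ne e with reverseView L
... | Reverse.[] = ⊥-elim (ne refl)
... | W ∶ _ ∶ʳ t = W , cong (λ s → W ++ s ∷ []) (proj₂ (∷ʳ-injective (X ++ W) Y (trans (++-assoc X W (t ∷ [])) e)))

split-ext : ∀ π X (u : ℕ) T N → π ++ N ∷ [] ≡ X ++ u ∷ T → ¬ u ≡ N → ∃ λ B → (π ≡ X ++ u ∷ B) × (B ++ N ∷ [] ≡ T)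
split-ext [] [] u T N e ne = ⊥-elim (ne (sym (proj₁ (∷-injective e))))
split-ext [] (x ∷ X) u T N e ne with ∷-injective e
split-ext [] (x ∷ []) u T N e ne | _ , ()
split-ext [] (x ∷ y ∷ X) u T N e ne | _ , ()
split-ext (p ∷ π) [] u T N e ne with ∷-injective e
... | refl , e2 = π , refl , e2
split-ext (p ∷ π) (x ∷ X) u T N e ne with ∷-injective e
... | refl , e2 with split-ext π X u T N e2 ne
...   | B , e3 , e4 = B , cong (p ∷_) e3 , e4

not-peak⇒< : ∀ v u w T → v < u → WellFormed (v ∷ u ∷ w ∷ T) → u ∉ peaks (v ∷ u ∷ w ∷ T) → u < w
not-peak⇒< v u w T v<u (_ , g) u∉ with u <? w
... | yes u<w = u<w
... | no u≮w = ⊥-elim (u∉ (subst (u ∈_) (sym (peaks-∷-true T (isPeak-true v<u (WellFormed-≮⇒> u w T u≮w g)))) (here refl)))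

peaks-suffix : ∀ Q v z r {x : ℕ} → x ∈ peaks (v ∷ z ∷ r) → x ∈ peaks (Q ++ v ∷ z ∷ r)
peaks-suffix Q v z r {x} p = subst (x ∈_) (sym (peaks≡centres (Q ++ v ∷ z ∷ r)))
  (subst (x ∈_) (sym (centres-++ isPeak Q v z r)) (∈-++⁺ʳ (centres isPeak (Q ++ v ∷ z ∷ [])) (subst (x ∈_) (peaks≡centres (v ∷ z ∷ r)) p)))

ext-last : ∀ π L (x : ℕ) → ext π ≡ L ++ x ∷ [] → x ≡ suc (suc (length π))
ext-last π L x e = sym (proj₂ (∷ʳ-injective (suc (length π) ∷ π) L e))

ext-bounded : ∀ π → (∀ x → x ∈ π → x ≤ length π) → ∀ x → x ∈ ext π → x ≤ suc (suc (length π))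
ext-bounded π b x (here refl) = n≤1+n _
ext-bounded π b x (there p) with ∈-++⁻ π p
... | inj₁ q = ≤-trans (b x q) (≤-trans (n≤1+n _) (n≤1+n _))
... | inj₂ (here refl) = ≤-refl

pin-cong : ∀ π π'' j → peaks (ext π'') ≡ peaks (ext π) → length π'' ≡ length π → pin π'' j ≡ pin π j
pin-cong π π'' zero pe le = cong suc le
pin-cong π π'' (suc j) pe le = cong₂ (λ l d → nth l j d) pe (cong (λ k → suc (suc k)) le)

dell-cong : ∀ π π'' j → valleys (ext π'') ≡ valleys (ext π) → dell π'' j ≡ dell π j
dell-cong π π'' j ve = cong (λ l → nth l (j ∸ 1) 0) ve

identityReversals : ∀ π p1 π' → π ≡ p1 ∷ π' → TwoReversals π π
identityReversals π p1 π' e = record { w₁ = p1 ; w₂ = p1 ; w₃ = p1 ; w₄ = p1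
  ; valid₁ = p1∈π , p1∈π , ≤-refl ; balanced₁ = balanced-if-fixed π ρπ≡π ; valid₂ = subst (λ m → ValidRev m p1 p1) (sym ρπ≡π) (p1∈π , p1∈π , ≤-refl)
  ; balanced₂ = balanced-if-fixed (ρ p1 p1 π) ρρπ≡ρπ ; result = trans ρρπ≡ρπ ρπ≡π }
  where
  p1∈π : p1 ∈ π
  p1∈π = subst (p1 ∈_) (sym e) (here refl)
  ρ-fixes : ∀ l → l ≡ p1 ∷ π' → ρ p1 p1 l ≡ l
  ρ-fixes l el = trans (cong (ρ p1 p1) el) (trans (ρ-single p1 [] π' (λ ())) (sym el))
  ρπ≡π : ρ p1 p1 π ≡ π
  ρπ≡π = ρ-fixes π e
  ρρπ≡ρπ : ρ p1 p1 (ρ p1 p1 π) ≡ ρ p1 p1 π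
  ρρπ≡ρπ = ρ-fixes (ρ p1 p1 π) (trans ρπ≡π e)
  balanced-if-fixed : ∀ l → ρ p1 p1 l ≡ l → Balanced l p1 p1
  balanced-if-fixed l h x = subst (λ m → (x ∈ pinnacles l) ⇔ (x ∈ pinnacles m)) (sym h) (mk⇔ (λ z → z) (λ z → z))

↭-moveRight : ∀ (A : List ℕ) v u K c B → (A ++ v ∷ u ∷ K ++ c ∷ B) ↭ (A ++ v ∷ K ++ u ∷ c ∷ B)
↭-moveRight A v u K c B = ++⁺ˡ A (prep v (↭-sym (shift u K (c ∷ B))))

↭-moveLeft : ∀ (A : List ℕ) c K' u B → (A ++ c ∷ K' ++ u ∷ B) ↭ (A ++ u ∷ c ∷ K' ++ B)
↭-moveLeft A c K' u B = ++⁺ˡ A (shift u (c ∷ K') B)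

Distinct-disjoint : ∀ X Y {y : ℕ} → Distinct (X ++ Y) → y ∈ Y → y ∉ X
Distinct-disjoint (x ∷ X) Y (nx , d) p (here refl) = nx (∈-++⁺ʳ X p)
Distinct-disjoint (x ∷ X) Y (nx , d) p (there q) = Distinct-disjoint X Y d p q

head-∈ : ∀ R1 (d : ℕ) T a T' → a ∷ T' ≡ R1 ++ d ∷ T → a ∈ R1 ++ d ∷ []
head-∈ [] d T a T' e = here (proj₁ (∷-injective e))
head-∈ (x ∷ R1) d T a T' e = here (proj₁ (∷-injective e))

uncons : ∀ (L : List ℕ) → ¬ L ≡ [] → ∃ λ h → ∃ λ A → L ≡ h ∷ A
uncons [] n = ⊥-elim (n refl)
uncons (h ∷ A) n = h , A , refl

++-∷-uncons : ∀ (L : List ℕ) z r → ∃ λ z' → ∃ λ R → L ++ z ∷ r ≡ z' ∷ R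
++-∷-uncons [] z r = z , r , refl
++-∷-uncons (x ∷ L) z r = x , L ++ z ∷ r , refl

peaks-unchanged : ∀ π π'' {E Em E''} → ext π ≡ E → ext π'' ≡ E'' → PeakSplit E Em E'' → peaks (ext π'') ≡ peaks (ext π)
peaks-unchanged π π'' e1 e2 S = trans (peaks≡centres (ext π'')) (trans (cong (centres isPeak) e2) (trans (PeakSplit.hE'' S)
   (trans (sym (PeakSplit.hE S)) (trans (cong (centres isPeak) (sym e1)) (sym (peaks≡centres (ext π)))))))

valleys-unchanged : ∀ π π'' {E E''} → ext π ≡ E → ext π'' ≡ E'' → centres isValley E'' ≡ centres isValley E → valleys (ext π'') ≡ valleys (ext π)
valleys-unchanged π π'' e1 e2 h = trans (valleys≡centres (ext π'')) (trans (cong (centres isValley) e2) (trans h (trans (cong (centres isValley) (sym e1)) (sym (valleys≡centres (ext π))))))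

Distinct-ext-↭ : ∀ π π'' → Distinct π → (∀ x → x ∈ π → x ≤ length π) → π ↭ π'' → Distinct (ext π'')
Distinct-ext-↭ π π'' d b p = Distinct-ext π'' (Distinct-resp-↭ p d) (λ x q → subst (x ≤_) (↭-length p) (b x (∈-resp-↭ (↭-sym p) q)))

Descending-last : ∀ R1 (d vq : ℕ) → Descending (R1 ++ d ∷ vq ∷ []) → vq < d
Descending-last [] d vq (p , _) = p
Descending-last (x ∷ []) d vq (_ , p , _) = p
Descending-last (x ∷ y ∷ R1) d vq (_ , rest) = Descending-last (y ∷ R1) d vq rest

Descending-init : ∀ a2 D2 (vq : ℕ) → Descending (a2 ∷ D2 ++ vq ∷ []) → ∃ λ R1 → ∃ λ d → (a2 ∷ D2 ≡ R1 ++ d ∷ []) × vq < d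
Descending-init a2 D2 vq dec = go (a2 ∷ D2) (reverseView (a2 ∷ D2)) refl
  where
  go : ∀ L → Reverse.Reverse L → L ≡ a2 ∷ D2 → ∃ λ R1 → ∃ λ d → (a2 ∷ D2 ≡ R1 ++ d ∷ []) × vq < d
  go .[] Reverse.[] ()
  go .(W ++ t ∷ []) (W ∶ _ ∶ʳ t) eL = W , t , sym eL , Descending-last W t vq (subst Descending (trans (cong (_++ vq ∷ []) (sym eL)) (++-assoc W (t ∷ []) (vq ∷ []))) dec)

<⇒+suc : ∀ k j → k < j → ∃ λ m → j ≡ k + suc m
<⇒+suc zero (suc j) p = j , refl
<⇒+suc (suc k) (suc j) (s≤s p) with <⇒+suc k j p
... | m , e = m , cong suc e

++-∷-nonempty : ∀ (L : List ℕ) a D → ¬ L ++ a ∷ D ≡ []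
++-∷-nonempty [] a D ()
++-∷-nonempty (x ∷ L) a D ()

-- The construction for π = p1 ∷ π', i = suc k and q = suc j, so that v_i = dell π (suc k)
-- and y_{q-1} = pin π j.
module Construction (p1 : ℕ) (π' : List ℕ) (dπ : Distinct (p1 ∷ π'))
  (bπ : ∀ x → x ∈ (p1 ∷ π') → 0 < x × x ≤ length (p1 ∷ π'))
  (k j : ℕ) (k≤j : k ≤ j) (j≤p : j ≤ length (peaks (ext (p1 ∷ π'))))
  (u∉pins : next (p1 ∷ π') (dell (p1 ∷ π') (suc k)) ∉ peaks (ext (p1 ∷ π')))
  (u<pin : next (p1 ∷ π') (dell (p1 ∷ π') (suc k)) < pin (p1 ∷ π') j) where

  π : List ℕ
  π = p1 ∷ π'
  N1 : ℕ
  N1 = suc (length π)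
  N2 : ℕ
  N2 = suc N1
  e : List ℕ
  e = ext π
  U : ℕ
  U = next π (dell π (suc k))

  Conclusion : Set
  Conclusion = ∃[ w₁ ] ∃[ w₂ ] ∃[ w₃ ] ∃[ w₄ ]
      (ValidRev π w₁ w₂ × Balanced π w₁ w₂ ×
       ValidRev (ρ w₁ w₂ π) w₃ w₄ × Balanced (ρ w₁ w₂ π) w₃ w₄ ×
       (dell π (suc j) < U →
          ρ w₃ w₄ (ρ w₁ w₂ π) ≡ moveBefore U (cutD π U j) π
          × U ∈ Dset (ρ w₃ w₄ (ρ w₁ w₂ π)) j) ×
       (U < dell π (suc j) →
          ρ w₃ w₄ (ρ w₁ w₂ π) ≡ moveBefore U (dell π (suc j)) π
          × dell (ρ w₃ w₄ (ρ w₁ w₂ π)) (suc j) ≡ U))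

  conclusion : ∀ {π''} u vq → U ≡ u → dell π (suc j) ≡ vq → TwoReversals π π'' →
         (vq < u → π'' ≡ moveBefore u (cutD π u j) π × u ∈ Dset π'' j) →
         (u < vq → π'' ≡ moveBefore u vq π × dell π'' (suc j) ≡ u) → Conclusion
  conclusion {π''} u vq refl refl T cut-case dell-case = TwoReversals.w₁ T , TwoReversals.w₂ T , TwoReversals.w₃ T , TwoReversals.w₄ T
    , TwoReversals.valid₁ T , TwoReversals.balanced₁ T , TwoReversals.valid₂ T , TwoReversals.balanced₂ T
    , (λ h → trans (TwoReversals.result T) (proj₁ (cut-case h)) , subst (λ t → U ∈ Dset t j) (sym (TwoReversals.result T)) (proj₂ (cut-case h)))
    , (λ h → trans (TwoReversals.result T) (proj₁ (dell-case h)) , subst (λ t → dell t (suc j) ≡ U) (sym (TwoReversals.result T)) (proj₂ (dell-case h)))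

  π-bounded : ∀ x → x ∈ π → x ≤ length π
  π-bounded x p = proj₂ (bπ x p)

  e-distinct : Distinct e
  e-distinct = Distinct-ext π dπ π-bounded

  e-bounded : ∀ x → x ∈ e → x ≤ N2
  e-bounded = ext-bounded π π-bounded

  p1<N1 : p1 < N1
  p1<N1 = s≤s (π-bounded p1 (here refl))

  e-wellFormed : WellFormed e
  e-wellFormed = WellFormed-ext N1 π N2 (λ p → proj₁ e-distinct (∈-++⁺ˡ p)) dπ (λ z p → s≤s (≤-trans (π-bounded z p) (n≤1+n _))) (n<1+n _)

  -- If u = v_q both implications are vacuous and reversing a single entry twice will do.
  conclusion-stay : ∀ u vq → U ≡ u → dell π (suc j) ≡ vq → u ≡ vq → Conclusion
  conclusion-stay u vq h1 h2 h3 = conclusion u vq h1 h2 (identityReversals π p1 π' refl) (λ h → ⊥-elim (<-irrefl (sym h3) h)) (λ h → ⊥-elim (<-irrefl h3 h))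

  below-pin : ∀ a → U ≡ a → ∀ {y} → pin π j ≡ y → a < y
  below-pin a ui pinj = subst (a <_) pinj (subst (_< pin π j) ui u<pin)

  cutD-unfold : ∀ u vq D → dell π (suc j) ≡ vq → Dset π j ≡ D → cutD π u j ≡ foldr _⊔_ 0 (filter (λ x → x <? u) (vq ∷ D))
  cutD-unfold u vq D h1 h2 = cong₂ (λ x D → foldr _⊔_ 0 (filter (λ x → x <? u) (x ∷ D))) h1 h2

  Dset-unfold : ∀ ρπ y vq → pin ρπ j ≡ y → dell ρπ (suc j) ≡ vq →
            Dset ρπ j ≡ take (indexOf vq (ext ρπ) ∸ suc (indexOf y (ext ρπ))) (drop (suc (indexOf y (ext ρπ))) (ext ρπ))
  Dset-unfold ρπ y vq h1 h2 = cong₂ (λ y vq → take (indexOf vq (ext ρπ) ∸ suc (indexOf y (ext ρπ))) (drop (suc (indexOf y (ext ρπ))) (ext ρπ))) h1 h2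

  -- Case i = q: u moves left into the descent ending at v_q = v_i.
  module SameRun (Pre : List ℕ) (a : ℕ) (D1 : List ℕ) (v z1 z : ℕ) (R : List ℕ)
    (eq : e ≡ Pre ++ a ∷ D1 ++ v ∷ z1 ∷ z ∷ R) (decD : Descending (a ∷ D1 ++ v ∷ [])) (v<z1 : v < z1)
    (gD : WellFormed (v ∷ z1 ∷ z ∷ R)) (ui : U ≡ z1) (dq : dell π (suc j) ≡ v) (pinj : pin π j ≡ a)
    (u∉ : z1 ∉ peaks (v ∷ z1 ∷ z ∷ R)) where
    u<a : z1 < a
    u<a = below-pin z1 ui pinj
    u<z : z1 < z
    u<z = not-peak⇒< v z1 z R v<z1 gD u∉
    e≡ : e ≡ (Pre ++ a ∷ D1 ++ v ∷ []) ++ z1 ∷ z ∷ R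
    e≡ = trans eq (trans (cong (λ t → Pre ++ a ∷ t) (sym (++-assoc D1 (v ∷ []) (z1 ∷ z ∷ R)))) (sym (++-assoc Pre (a ∷ D1 ++ v ∷ []) (z1 ∷ z ∷ R))))
    z1-fresh : (z1 ∉ Pre ++ a ∷ D1 ++ v ∷ []) × (z1 ∉ z ∷ R)
    z1-fresh = Distinct-∉ (Pre ++ a ∷ D1 ++ v ∷ []) z1 (z ∷ R) (subst Distinct e≡ e-distinct)
    u∉D1 : z1 ∉ D1
    u∉D1 p = proj₁ z1-fresh (∈-++⁺ʳ Pre (there (∈-++⁺ˡ p)))
    C : CutPoint z1 a D1 v
    C = cutPoint z1 a D1 v decD u<a v<z1 u∉D1
    open CutPoint C using (R1; d; c; R2; u<d; c<u; c-is-max)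
    eqC' : (R1 ++ d ∷ []) ++ c ∷ R2 ≡ (a ∷ D1) ++ v ∷ []
    eqC' = trans (++-assoc R1 (d ∷ []) (c ∷ R2)) (sym (CutPoint.eq C))
    K0 : List ℕ
    K0 = proj₁ (last-segment (R1 ++ d ∷ []) (c ∷ R2) (a ∷ D1) v (λ ()) eqC')
    K-last : c ∷ R2 ≡ K0 ++ v ∷ []
    K-last = proj₂ (last-segment (R1 ++ d ∷ []) (c ∷ R2) (a ∷ D1) v (λ ()) eqC')
    P : List ℕ
    P = Pre ++ R1
    e≡′ : e ≡ (P ++ d ∷ []) ++ c ∷ R2 ++ z1 ∷ z ∷ R
    e≡′ = trans eq (trans (cong (λ t → Pre ++ a ∷ t) (sym (++-assoc D1 (v ∷ []) (z1 ∷ z ∷ R))))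
            (trans (cong (λ t → Pre ++ t ++ z1 ∷ z ∷ R) (CutPoint.eq C))
             (trans (cong (Pre ++_) (trans (++-assoc R1 (d ∷ c ∷ R2) (z1 ∷ z ∷ R)) (sym (++-assoc R1 (d ∷ []) (c ∷ R2 ++ z1 ∷ z ∷ R)))))
              (trans (sym (++-assoc Pre (R1 ++ d ∷ []) _)) (cong (_++ c ∷ R2 ++ z1 ∷ z ∷ R) (sym (++-assoc Pre R1 (d ∷ []))))))))
    split-head : ∃ λ h → ∃ λ A → P ++ d ∷ [] ≡ h ∷ A
    split-head = uncons (P ++ d ∷ []) (++-∷-nonempty P d [])
    h : ℕ
    h = proj₁ split-head
    A : List ℕ
    A = proj₁ (proj₂ split-head)
    split-head≡ : P ++ d ∷ [] ≡ h ∷ A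
    split-head≡ = proj₂ (proj₂ split-head)
    e≡″ : N1 ∷ (π ++ N2 ∷ []) ≡ h ∷ (A ++ c ∷ R2 ++ z1 ∷ z ∷ R)
    e≡″ = trans e≡′ (cong (_++ c ∷ R2 ++ z1 ∷ z ∷ R) split-head≡)
    head≡N1 : N1 ≡ h
    head≡N1 = proj₁ (∷-injective e≡″)
    prefix≡ : N1 ∷ A ≡ P ++ d ∷ []
    prefix≡ = trans (cong (_∷ A) head≡N1) (sym split-head≡)
    z1≠N2 : ¬ z1 ≡ N2
    z1≠N2 e' = <-irrefl e' (<-≤-trans u<a (e-bounded a (subst (a ∈_) (sym eq) (∈-middle Pre _))))
    π-split : ∃ λ B → (π ≡ (A ++ c ∷ R2) ++ z1 ∷ B) × (B ++ N2 ∷ [] ≡ z ∷ R)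
    π-split = split-ext π (A ++ c ∷ R2) z1 (z ∷ R) N2 (trans (proj₂ (∷-injective e≡″)) (sym (++-assoc A (c ∷ R2) (z1 ∷ z ∷ R)))) z1≠N2
    B : List ℕ
    B = proj₁ π-split
    π≡ : π ≡ A ++ c ∷ R2 ++ z1 ∷ B
    π≡ = trans (proj₁ (proj₂ π-split)) (++-assoc A (c ∷ R2) (z1 ∷ B))
    module LP = MoveLeft π A P d c (c ∷ R2) R2 K0 v z1 B z R π≡ refl K-last prefix≡ (proj₂ (proj₂ π-split)) dπ
           (<-trans c<u u<d) u<d c<u v<z1 u<z
    π'' : List ℕ
    π'' = A ++ z1 ∷ (c ∷ R2) ++ B
    dell-case : z1 < v → π'' ≡ moveBefore z1 v π × dell π'' (suc j) ≡ z1
    dell-case h = ⊥-elim (<-asym h v<z1)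
    Dset≡ : Dset π j ≡ D1
    Dset≡ = trans (Dset-unfold π a v pinj dq) (between-++ e Pre a D1 v (z1 ∷ z ∷ R) eq
              (proj₁ (Distinct-∉ Pre a _ (subst Distinct eq e-distinct)))
              (proj₁ (Distinct-∉ (Pre ++ a ∷ D1) v _ (subst Distinct (trans eq (sym (++-assoc Pre (a ∷ D1) _))) e-distinct))))
    cutD≡ : cutD π z1 j ≡ c
    cutD≡ = trans (cutD-unfold z1 v D1 dq Dset≡) c-is-max
    peaks≡ : peaks (ext π'') ≡ peaks (ext π)
    peaks≡ = peaks-unchanged π π'' (LP.ext-before) (LP.ext-after) (LP.peakSplit)
    valleys≡ : valleys (ext π'') ≡ valleys (ext π)
    valleys≡ = valleys-unchanged π π'' (LP.ext-before) (LP.ext-after) (valleys-moveLeft P d z1 (c ∷ R2) c R2 K0 v z R refl K-last (<-trans c<u u<d) u<d c<u v<z1 u<z)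
    pin-after : pin π'' j ≡ a
    pin-after = trans (pin-cong π π'' j peaks≡ (LP.length-after)) pinj
    dell-after : dell π'' (suc j) ≡ v
    dell-after = trans (dell-cong π π'' (suc j) valleys≡) dq
    distinct-after : Distinct (ext π'')
    distinct-after = Distinct-ext-↭ π π'' dπ π-bounded (subst (_↭ π'') (sym π≡) (↭-moveLeft A c R2 z1 B))
    L1 : List ℕ
    L1 = P ++ d ∷ []
    L2 : List ℕ
    L2 = (c ∷ R2) ++ z ∷ R
    ext-after≡ : ext π'' ≡ L1 ++ z1 ∷ L2
    ext-after≡ = trans (LP.ext-after) (sym (++-assoc P (d ∷ []) (z1 ∷ L2)))
    a∈L1 : a ∈ L1
    a∈L1 = subst (a ∈_) (sym (++-assoc Pre R1 (d ∷ []))) (∈-++⁺ʳ Pre (head-∈ R1 d (c ∷ R2) a (D1 ++ v ∷ []) (CutPoint.eq C)))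
    v∈L2 : v ∈ L2
    v∈L2 = ∈-++⁺ˡ (subst (v ∈_) (sym K-last) (∈-++⁺ʳ K0 (here refl)))
    distinct-after′ : Distinct (L1 ++ z1 ∷ L2)
    distinct-after′ = subst Distinct ext-after≡ distinct-after
    cut-case : v < z1 → π'' ≡ moveBefore z1 (cutD π z1 j) π × z1 ∈ Dset π'' j
    cut-case h = trans (sym (LP.moveBefore-result)) (cong (λ t → moveBefore z1 t π) (sym cutD≡))
         , subst (z1 ∈_) (sym (Dset-unfold π'' a v pin-after dell-after))
             (∈-between (ext π'') L1 z1 L2 a v ext-after≡ a∈L1 (proj₁ (Distinct-∉ L1 z1 L2 distinct-after′))
               (Distinct-disjoint (L1 ++ z1 ∷ []) L2 (subst Distinct (sym (++-assoc L1 (z1 ∷ []) L2)) distinct-after′) v∈L2))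

    result : Conclusion
    result = conclusion z1 v ui dq LP.reversals cut-case dell-case

  sameRun : ∀ Pre a D1 v z1 r1 → e ≡ Pre ++ a ∷ D1 ++ v ∷ z1 ∷ r1 → Descending (a ∷ D1 ++ v ∷ []) → v < z1 → WellFormed (v ∷ z1 ∷ r1) →
         U ≡ z1 → dell π (suc j) ≡ v → pin π j ≡ a → z1 ∉ peaks (v ∷ z1 ∷ r1) → Conclusion
  -- If u were the last entry of ext π, it would be n + 2 > y_{q-1}.
  sameRun Pre a D1 v z1 [] eq decD v<z1 gD ui dq pinj u∉ =
    ⊥-elim (<-irrefl refl (<-≤-trans (subst (_< a) zN (below-pin z1 ui pinj)) (e-bounded a (subst (a ∈_) (sym eq) (∈-middle Pre _)))))
    where
    eq' : e ≡ (Pre ++ a ∷ D1 ++ v ∷ []) ++ z1 ∷ []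
    eq' = trans eq (trans (cong (λ t → Pre ++ a ∷ t) (sym (++-assoc D1 (v ∷ []) (z1 ∷ [])))) (sym (++-assoc Pre (a ∷ D1 ++ v ∷ []) (z1 ∷ []))))
    zN : z1 ≡ N2
    zN = ext-last π _ z1 eq'
  sameRun Pre a D1 v z1 (z ∷ R) eq decD v<z1 gD ui dq pinj u∉ = SameRun.result Pre a D1 v z1 z R eq decD v<z1 gD ui dq pinj u∉

  -- The entry c in front of which u lands when it moves right: the cut point when v_q < u,
  -- and v_q itself when u < v_q.
  RightMoveCase : ℕ → ℕ → ℕ → List ℕ → ℕ → List ℕ → Set
  RightMoveCase z1 vq c D2 z R = ((vq < z1) × (c < z1) × (foldr _⊔_ 0 (filter (λ x → x <? z1) (vq ∷ D2)) ≡ c) × (vq ∈ c ∷ z ∷ R)) ⊎ ((z1 < vq) × (c ≡ vq) × (c < z))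

  module RightMove (Pre : List ℕ) (a : ℕ) (D1 : List ℕ) (v z1 : ℕ) (W : List ℕ) (a2 : ℕ) (D2 : List ℕ) (vq z2 : ℕ) (r4 R1 : List ℕ)
    (d c z : ℕ) (R : List ℕ)
    (eR : e ≡ (Pre ++ a ∷ D1) ++ v ∷ z1 ∷ W ++ a2 ∷ D2 ++ vq ∷ z2 ∷ r4)
    (eqRun : a2 ∷ D2 ++ vq ∷ z2 ∷ r4 ≡ R1 ++ d ∷ c ∷ z ∷ R)
    (v<z1 : v < z1) (gD : WellFormed (v ∷ z1 ∷ W ++ a2 ∷ D2 ++ vq ∷ z2 ∷ r4)) (u∉ : z1 ∉ peaks (v ∷ z1 ∷ W ++ a2 ∷ D2 ++ vq ∷ z2 ∷ r4))
    (ui : U ≡ z1) (pinj : pin π j ≡ a2) (dq : dell π (suc j) ≡ vq)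
    (u<d : z1 < d) (c<d : c < d) (flag : RightMoveCase z1 vq c D2 z R) where
    Q : List ℕ
    Q = Pre ++ a ∷ D1
    K : List ℕ
    K = W ++ R1 ++ d ∷ []
    tail≡ : W ++ a2 ∷ D2 ++ vq ∷ z2 ∷ r4 ≡ K ++ c ∷ z ∷ R
    tail≡ = trans (cong (W ++_) eqRun) (trans (cong (W ++_) (sym (++-assoc R1 (d ∷ []) (c ∷ z ∷ R)))) (sym (++-assoc W (R1 ++ d ∷ []) (c ∷ z ∷ R))))
    e≡ : e ≡ Q ++ v ∷ z1 ∷ K ++ c ∷ z ∷ R
    e≡ = trans eR (cong (λ t → Q ++ v ∷ z1 ∷ t) tail≡)
    Q-uncons : ∃ λ h → ∃ λ A → Q ≡ h ∷ A
    Q-uncons = uncons Q (++-∷-nonempty Pre a D1)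
    A : List ℕ
    A = proj₁ (proj₂ Q-uncons)
    e≡′ : N1 ∷ (π ++ N2 ∷ []) ≡ proj₁ Q-uncons ∷ (A ++ v ∷ z1 ∷ K ++ c ∷ z ∷ R)
    e≡′ = trans e≡ (cong (_++ v ∷ z1 ∷ K ++ c ∷ z ∷ R) (proj₂ (proj₂ Q-uncons)))
    d∈K : d ∈ K
    d∈K = ∈-++⁺ʳ W (∈-++⁺ʳ R1 (here refl))
    d∈e : d ∈ e
    d∈e = subst (d ∈_) (sym e≡) (∈-++⁺ʳ Q (there (there (∈-++⁺ˡ d∈K))))
    c≠N2 : ¬ c ≡ N2
    c≠N2 ce = <-irrefl ce (<-≤-trans c<d (e-bounded d d∈e))
    π-split : ∃ λ B → (π ≡ (A ++ v ∷ z1 ∷ K) ++ c ∷ B) × (B ++ N2 ∷ [] ≡ z ∷ R)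
    π-split = split-ext π (A ++ v ∷ z1 ∷ K) c (z ∷ R) N2 (trans (proj₂ (∷-injective e≡′)) (sym (++-assoc A (v ∷ z1 ∷ K) (c ∷ z ∷ R)))) c≠N2
    B : List ℕ
    B = proj₁ π-split
    π≡ : π ≡ A ++ v ∷ z1 ∷ K ++ c ∷ B
    π≡ = trans (proj₁ (proj₂ π-split)) (++-assoc A (v ∷ z1 ∷ K) (c ∷ B))
    K≢[] : ¬ K ≡ []
    K≢[] eq = ++-∷-nonempty (W ++ R1) d [] (trans (++-assoc W R1 (d ∷ [])) eq)
    K-uncons : ∃ λ w → ∃ λ K' → K ≡ w ∷ K'
    K-uncons = uncons K K≢[]
    w : ℕ
    w = proj₁ K-uncons
    K' : List ℕ
    K' = proj₁ (proj₂ K-uncons)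
    K-head : K ≡ w ∷ K'
    K-head = proj₂ (proj₂ K-uncons)
    K0 : List ℕ
    K0 = W ++ R1
    K-last : K ≡ K0 ++ d ∷ []
    K-last = sym (++-assoc W R1 (d ∷ []))
    tail≡′ : W ++ a2 ∷ D2 ++ vq ∷ z2 ∷ r4 ≡ w ∷ K' ++ c ∷ z ∷ R
    tail≡′ = trans tail≡ (cong (_++ c ∷ z ∷ R) K-head)
    u<w : z1 < w
    u<w = not-peak⇒< v z1 w (K' ++ c ∷ z ∷ R) v<z1 (subst (λ t → WellFormed (v ∷ z1 ∷ t)) tail≡′ gD) (subst (λ t → z1 ∉ peaks (v ∷ z1 ∷ t)) tail≡′ u∉)
    c-low : c < z1 ⊎ c < z
    c-low = c-low-by-case flag
      where c-low-by-case : RightMoveCase z1 vq c D2 z R → c < z1 ⊎ c < z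
            c-low-by-case (inj₁ (_ , p , _)) = inj₁ p
            c-low-by-case (inj₂ (_ , _ , p)) = inj₂ p
    module RP = MoveRight π A v z1 K w K' K0 d c B z R π≡ K-head K-last (proj₂ (proj₂ π-split)) dπ v<z1 u<w u<d c<d c-low
    π'' : List ℕ
    π'' = A ++ v ∷ K ++ z1 ∷ c ∷ B
    P : List ℕ
    P = N1 ∷ A
    eR' : e ≡ (Q ++ v ∷ z1 ∷ W) ++ a2 ∷ D2 ++ vq ∷ z2 ∷ r4
    eR' = trans eR (sym (++-assoc Q (v ∷ z1 ∷ W) _))
    eR'' : e ≡ ((Q ++ v ∷ z1 ∷ W) ++ a2 ∷ D2) ++ vq ∷ z2 ∷ r4
    eR'' = trans eR' (sym (++-assoc (Q ++ v ∷ z1 ∷ W) (a2 ∷ D2) _))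
    Dset≡ : Dset π j ≡ D2
    Dset≡ = trans (Dset-unfold π a2 vq pinj dq) (between-++ e (Q ++ v ∷ z1 ∷ W) a2 D2 vq (z2 ∷ r4) eR'
              (proj₁ (Distinct-∉ _ a2 _ (subst Distinct eR' e-distinct))) (proj₁ (Distinct-∉ _ vq _ (subst Distinct eR'' e-distinct))))
    peaks≡ : peaks (ext π'') ≡ peaks (ext π)
    peaks≡ = peaks-unchanged π π'' RP.ext-before RP.ext-after RP.peakSplit
    pin-after : pin π'' j ≡ a2
    pin-after = trans (pin-cong π π'' j peaks≡ RP.length-after) pinj
    distinct-after : Distinct (ext π'')
    distinct-after = Distinct-ext-↭ π π'' dπ π-bounded (subst (_↭ π'') (sym π≡) (↭-moveRight A v z1 K c B))
    L1 : List ℕ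
    L1 = P ++ v ∷ K
    L2 : List ℕ
    L2 = c ∷ z ∷ R
    ext-after≡ : ext π'' ≡ L1 ++ z1 ∷ L2
    ext-after≡ = trans RP.ext-after (sym (++-assoc P (v ∷ K) (z1 ∷ L2)))
    distinct-after′ : Distinct (L1 ++ z1 ∷ L2)
    distinct-after′ = subst Distinct ext-after≡ distinct-after
    a2∈K : a2 ∈ K
    a2∈K = ∈-++⁺ʳ W (head-∈ R1 d (c ∷ z ∷ R) a2 (D2 ++ vq ∷ z2 ∷ r4) eqRun)
    cut-case : vq < z1 → π'' ≡ moveBefore z1 (cutD π z1 j) π × z1 ∈ Dset π'' j
    cut-case h = cut-case′ flag
      where
      cut-case′ : RightMoveCase z1 vq c D2 z R → π'' ≡ moveBefore z1 (cutD π z1 j) π × z1 ∈ Dset π'' j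
      cut-case′ (inj₂ (z1<vq , _)) = ⊥-elim (<-asym h z1<vq)
      cut-case′ (inj₁ (_ , c<z1 , c-is-max , vqL2)) =
          trans (sym RP.moveBefore-result) (cong (λ t → moveBefore z1 t π) (sym (trans (cutD-unfold z1 vq D2 dq Dset≡) c-is-max)))
        , subst (z1 ∈_) (sym (Dset-unfold π'' a2 vq pin-after dell-after))
            (∈-between (ext π'') L1 z1 L2 a2 vq ext-after≡ (∈-++⁺ʳ P (there a2∈K)) (proj₁ (Distinct-∉ L1 z1 L2 distinct-after′))
              (Distinct-disjoint (L1 ++ z1 ∷ []) L2 (subst Distinct (sym (++-assoc L1 (z1 ∷ []) L2)) distinct-after′) vqL2))
        where
        valleys≡ : valleys (ext π'') ≡ valleys (ext π)
        valleys≡ = valleys-unchanged π π'' RP.ext-before RP.ext-after (valleys-moveRight-below P v z1 K w K' K0 d c z R K-head K-last v<z1 u<w u<d c<z1)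
        dell-after : dell π'' (suc j) ≡ vq
        dell-after = trans (dell-cong π π'' (suc j) valleys≡) dq
    dell-case : z1 < vq → π'' ≡ moveBefore z1 vq π × dell π'' (suc j) ≡ z1
    dell-case h = dell-case′ flag
      where
      dell-case′ : RightMoveCase z1 vq c D2 z R → π'' ≡ moveBefore z1 vq π × dell π'' (suc j) ≡ z1
      dell-case′ (inj₁ (vq<z1 , _)) = ⊥-elim (<-asym h vq<z1)
      dell-case′ (inj₂ (_ , refl , c<z)) = sym RP.moveBefore-result , u-is-dell
        where
        -- In the valleys of ext π, v_q = c sits at index j; in those of ext π'', u takes its place.
        V1 : List ℕ
        V1 = centres isValley (P ++ v ∷ z1 ∷ []) ++ centres isValley (z1 ∷ K ++ c ∷ [])
        V3 : List ℕ
        V3 = centres isValley (c ∷ z ∷ R)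
        valleys-split : (centres isValley (P ++ v ∷ z1 ∷ K ++ c ∷ z ∷ R) ≡ V1 ++ c ∷ V3) × (centres isValley (P ++ v ∷ K ++ z1 ∷ c ∷ z ∷ R) ≡ V1 ++ z1 ∷ V3)
        valleys-split = valleys-moveRight-above P v z1 K w K' K0 d c z R K-head K-last v<z1 u<w u<d h c<d c<z
        e≡c : e ≡ (P ++ v ∷ z1 ∷ K) ++ c ∷ z ∷ R
        e≡c = trans RP.ext-before (sym (++-assoc P (v ∷ z1 ∷ K) (c ∷ z ∷ R)))
        dc : (c ∉ P ++ v ∷ z1 ∷ K) × (c ∉ z ∷ R)
        dc = Distinct-∉ (P ++ v ∷ z1 ∷ K) c (z ∷ R) (subst Distinct e≡c e-distinct)
        c∉V1 : c ∉ V1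
        c∉V1 p with ∈-++⁻ (centres isValley (P ++ v ∷ z1 ∷ [])) p
        ... | inj₁ q = proj₁ dc (widen (centres-⊆-init isValley (P ++ v ∷ []) z1 (subst (c ∈_) (cong (centres isValley) (sym (++-assoc P (v ∷ []) (z1 ∷ [])))) q)))
          where widen : c ∈ P ++ v ∷ [] → c ∈ P ++ v ∷ z1 ∷ K
                widen r with ∈-++⁻ P r
                ... | inj₁ s = ∈-++⁺ˡ s
                ... | inj₂ (here s) = ∈-++⁺ʳ P (here s)
        ... | inj₂ q = proj₁ dc (∈-++⁺ʳ P (there (centres-⊆-init isValley (z1 ∷ K) c q)))
        c∉V3 : c ∉ V3
        c∉V3 p = proj₂ dc (centres-⊆-tail isValley c (z ∷ R) p)
        c∈π : c ∈ π
        c∈π = subst (c ∈_) (sym π≡) (∈-++⁺ʳ A (there (there (∈-++⁺ʳ K (here refl)))))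
        valleys≡ : valleys e ≡ V1 ++ c ∷ V3
        valleys≡ = trans (valleys≡centres e) (trans (cong (centres isValley) RP.ext-before) (proj₁ valleys-split))
        j≡index : j ≡ length V1
        j≡index = nth-index V1 c V3 j 0 c∉V1 c∉V3 (λ ce → <-irrefl (sym ce) (proj₁ (bπ c c∈π))) (trans (cong (λ l → nth l j 0) (sym valleys≡)) dq)
        u-is-dell : dell π'' (suc j) ≡ z1
        u-is-dell = trans (cong (λ l → nth l j 0) (trans (valleys≡centres (ext π'')) (trans (cong (centres isValley) RP.ext-after) (proj₂ valleys-split))))
                 (trans (cong (λ t → nth (V1 ++ z1 ∷ V3) t 0) j≡index) (nth-++ V1 z1 V3 0))

    result : Conclusion
    result = conclusion z1 vq ui dq RP.reversals cut-case dell-case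

  -- Case i < q: v_q is the bottom of the descent starting at y_{q-1} further right.
  module LaterRunAtDell (Pre : List ℕ) (a : ℕ) (D1 : List ℕ) (v z1 : ℕ) (W : List ℕ) (a2 : ℕ) (D2 : List ℕ) (vq z2 : ℕ) (r4 : List ℕ)
    (eR : e ≡ (Pre ++ a ∷ D1) ++ v ∷ z1 ∷ W ++ a2 ∷ D2 ++ vq ∷ z2 ∷ r4)
    (decD2 : Descending (a2 ∷ D2 ++ vq ∷ [])) (v<z1 : v < z1) (vq<z2 : vq < z2)
    (gD : WellFormed (v ∷ z1 ∷ W ++ a2 ∷ D2 ++ vq ∷ z2 ∷ r4)) (u∉ : z1 ∉ peaks (v ∷ z1 ∷ W ++ a2 ∷ D2 ++ vq ∷ z2 ∷ r4))
    (ui : U ≡ z1) (pinj : pin π j ≡ a2) (dq : dell π (suc j) ≡ vq) where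

    cut-case : vq < z1 → Conclusion
    cut-case vq<z1 = RightMove.result Pre a D1 v z1 W a2 D2 vq z2 r4 R1 d c z R eR eqRun v<z1 gD u∉ ui pinj dq
        u<d (<-trans c<u u<d) (inj₁ (vq<z1 , c<u , c-is-max , vq∈))
      where
      eR2 : e ≡ ((Pre ++ a ∷ D1) ++ v ∷ []) ++ z1 ∷ W ++ a2 ∷ D2 ++ vq ∷ z2 ∷ r4
      eR2 = trans eR (sym (++-assoc (Pre ++ a ∷ D1) (v ∷ []) _))
      u∉D2 : z1 ∉ D2
      u∉D2 p = proj₂ (Distinct-∉ _ z1 _ (subst Distinct eR2 e-distinct)) (∈-++⁺ʳ W (there (∈-++⁺ˡ p)))
      C : CutPoint z1 a2 D2 vq
      C = cutPoint z1 a2 D2 vq decD2 (below-pin z1 ui pinj) vq<z1 u∉D2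
      open CutPoint C using (R1; d; c; R2; u<d; c<u; c-is-max)
      zR : ∃ λ z → ∃ λ R → R2 ++ z2 ∷ r4 ≡ z ∷ R
      zR = ++-∷-uncons R2 z2 r4
      z : ℕ
      z = proj₁ zR
      R : List ℕ
      R = proj₁ (proj₂ zR)
      eqRun : a2 ∷ D2 ++ vq ∷ z2 ∷ r4 ≡ R1 ++ d ∷ c ∷ z ∷ R
      eqRun = trans (cong (a2 ∷_) (sym (++-assoc D2 (vq ∷ []) (z2 ∷ r4))))
               (trans (cong (_++ z2 ∷ r4) (CutPoint.eq C)) (trans (++-assoc R1 (d ∷ c ∷ R2) (z2 ∷ r4)) (cong (λ t → R1 ++ d ∷ c ∷ t) (proj₂ (proj₂ zR)))))
      eqC' : (R1 ++ d ∷ []) ++ c ∷ R2 ≡ (a2 ∷ D2) ++ vq ∷ []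
      eqC' = trans (++-assoc R1 (d ∷ []) (c ∷ R2)) (sym (CutPoint.eq C))
      lv : ∃ λ K0 → c ∷ R2 ≡ K0 ++ vq ∷ []
      lv = last-segment (R1 ++ d ∷ []) (c ∷ R2) (a2 ∷ D2) vq (λ ()) eqC'
      vq∈ : vq ∈ c ∷ z ∷ R
      vq∈ = subst (vq ∈_) (cong (c ∷_) (proj₂ (proj₂ zR))) (∈-++⁺ˡ (subst (vq ∈_) (sym (proj₂ lv)) (∈-++⁺ʳ (proj₁ lv) (here refl))))

    dell-case : z1 < vq → Conclusion
    dell-case z1<vq = RightMove.result Pre a D1 v z1 W a2 D2 vq z2 r4 R1 d vq z2 r4 eR eqRun v<z1 gD u∉ ui pinj dq
        (<-trans z1<vq vq<d) vq<d (inj₂ (z1<vq , refl , vq<z2))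
      where
      ds : ∃ λ R1 → ∃ λ d → (a2 ∷ D2 ≡ R1 ++ d ∷ []) × vq < d
      ds = Descending-init a2 D2 vq decD2
      R1 : List ℕ
      R1 = proj₁ ds
      d : ℕ
      d = proj₁ (proj₂ ds)
      vq<d : vq < d
      vq<d = proj₂ (proj₂ (proj₂ ds))
      eqRun : a2 ∷ D2 ++ vq ∷ z2 ∷ r4 ≡ R1 ++ d ∷ vq ∷ z2 ∷ r4
      eqRun = trans (cong (_++ vq ∷ z2 ∷ r4) (proj₁ (proj₂ (proj₂ ds)))) (++-assoc R1 (d ∷ []) (vq ∷ z2 ∷ r4))

    result : Conclusion
    result with <-cmp vq z1
    ... | tri≈ _ vq≡z1 _ = conclusion-stay z1 vq ui dq (sym vq≡z1)
    ... | tri< vq<z1 _ _ = cut-case vq<z1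
    ... | tri> _ _ z1<vq = dell-case z1<vq

  laterRun : ∀ Pre a D1 v z1 r1 → e ≡ Pre ++ a ∷ D1 ++ v ∷ z1 ∷ r1 → v < z1 → WellFormed (v ∷ z1 ∷ r1) → U ≡ z1 →
         z1 ∉ peaks (v ∷ z1 ∷ r1) →
         (∀ t d → nth (peaks e) (k + t) d ≡ nth (peaks (v ∷ z1 ∷ r1)) t d) →
         (∀ t d → nth (valleys e) (k + suc t) d ≡ nth (valleys (v ∷ z1 ∷ r1)) t d) →
         length (peaks e) ≡ k + length (peaks (v ∷ z1 ∷ r1)) → k < j → Conclusion
  laterRun Pre a D1 v z1 r1 eq v<z1 gD ui u∉ hp hv hl k<j = afterAscent (ascentRun v z1 r1 v<z1 gD)
    where
    afterAscent : peaks (v ∷ z1 ∷ r1) ≡ [] ⊎ AscentRun v z1 r1 → Conclusion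
    afterAscent (inj₁ pz) = ⊥-elim (<-irrefl refl (<-≤-trans k<j (≤-trans j≤p (≤-reflexive (trans hl (trans (cong (λ l → k + length l) pz) (+-identityʳ k)))))))
    afterAscent (inj₂ record { U = [] ; y = y1 ; eq = eqA ; peak = peakA }) =
      ⊥-elim (u∉ (subst (z1 ∈_) (sym peakA) (here (proj₁ (∷-injective eqA)))))
    afterAscent (inj₂ record { U = h ∷ U' ; y = y1 ; y' = y' ; r' = r2 ; eq = eqA ; y'<y = y'<y1 ; good = gA ; peak = peakA ; vall = vallA }) =
      atPin (fromPin m y1 y' r2 y'<y1 gA m≤)
      where
      m : ℕ
      m = proj₁ (<⇒+suc k j k<j)
      jE : j ≡ k + suc m
      jE = proj₂ (<⇒+suc k j k<j)
      m≤ : m ≤ length (peaks (y1 ∷ y' ∷ r2))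
      m≤ = ≤-pred (+-cancelˡ-≤ k (suc m) (suc (length (peaks (y1 ∷ y' ∷ r2)))) (subst (_≤ k + suc (length (peaks (y1 ∷ y' ∷ r2)))) jE
              (≤-trans j≤p (≤-reflexive (trans hl (cong (λ l → k + length l) peakA))))))
      r1E : r1 ≡ U' ++ y1 ∷ y' ∷ r2
      r1E = proj₂ (∷-injective eqA)
      atPin : FromPin m (y1 ∷ y' ∷ r2) → Conclusion
      atPin record { Pre = Pre2 ; a = a2 ; b = b2 ; r = r3 ; eq = eq2 ; b<a = b2<a2 ; good = g2 ; vnth = vn2 ; top = tp2 } =
        atDell (descentRun a2 b2 r3 b2<a2 g2)
        where
        pinj : pin π j ≡ a2
        pinj = trans (cong (pin π) (trans jE (+-suc k m)))
                 (trans (hp m N2) (trans (cong (λ l → nth l m N2) peakA)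
                   (IsPin-∷ m y1 (peaks (y1 ∷ y' ∷ r2)) (y1 ∷ y' ∷ r2) a2 tp2 refl (λ r ee → proj₁ (∷-injective ee)) N2)))
        atDell : DescentRun a2 b2 r3 → Conclusion
        atDell record { D = D2 ; v = vq ; z = z2 ; r' = r4 ; eq = eqD2 ; dec = decD2 ; v<z = vq<z2 ; vall = vallD2 } =
          LaterRunAtDell.result Pre a D1 v z1 W a2 D2 vq z2 r4 eR decD2 v<z1 vq<z2
            (subst (λ t → WellFormed (v ∷ z1 ∷ t)) r1E' gD) (subst (λ t → z1 ∉ peaks (v ∷ z1 ∷ t)) r1E' u∉) ui pinj dq
          where
          dq : dell π (suc j) ≡ vq
          dq = trans (cong (λ t → nth (valleys e) t 0) jE) (trans (hv m 0) (trans (cong (λ l → nth l m 0) vallA)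
                 (trans (cong (λ t → nth (valleys (y1 ∷ y' ∷ r2)) t 0) (sym (+-identityʳ m)))
                   (trans (vn2 0 0) (cong (λ l → nth l 0 0) vallD2)))))
          W : List ℕ
          W = U' ++ Pre2
          r1E' : r1 ≡ W ++ a2 ∷ D2 ++ vq ∷ z2 ∷ r4
          r1E' = trans r1E (trans (cong (U' ++_) (trans eq2 (cong (λ t → Pre2 ++ a2 ∷ t) eqD2))) (sym (++-assoc U' Pre2 _)))
          eR : e ≡ (Pre ++ a ∷ D1) ++ v ∷ z1 ∷ W ++ a2 ∷ D2 ++ vq ∷ z2 ∷ r4
          eR = trans eq (trans (sym (++-assoc Pre (a ∷ D1) _)) (cong (λ t → (Pre ++ a ∷ D1) ++ v ∷ z1 ∷ t) r1E'))

  pin-IsPin : ∀ k' a → IsPin k' e a → pin π k' ≡ a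
  pin-IsPin zero a (r , ee) = proj₁ (∷-injective ee)
  pin-IsPin (suc k') a t = t N2

  result : Conclusion
  result = fromPinᵢ (fromPin k N1 p1 (π' ++ N2 ∷ []) p1<N1 e-wellFormed (≤-trans k≤j j≤p))
    where
    fromPinᵢ : FromPin k e → Conclusion
    fromPinᵢ record { Pre = Pre ; a = a ; b = b ; r = r ; eq = eqS ; b<a = b<a ; good = g ; vnth = vn ; pnth = pn ; len = ln ; top = tp } =
      fromDescentᵢ (descentRun a b r b<a g)
      where
      fromDescentᵢ : DescentRun a b r → Conclusion
      fromDescentᵢ record { D = D1 ; v = v ; z = z1 ; r' = r1 ; eq = eqD ; dec = decD ; v<z = v<z1 ; good = gD ; vall = vallD ; peak = peakD } =
        byCase (m≤n⇒m<n∨m≡n k≤j)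
        where
        eq : e ≡ Pre ++ a ∷ D1 ++ v ∷ z1 ∷ r1
        eq = trans eqS (cong (λ t → Pre ++ a ∷ t) eqD)
        Q : List ℕ
        Q = Pre ++ a ∷ D1
        eQ : e ≡ Q ++ v ∷ z1 ∷ r1
        eQ = trans eq (sym (++-assoc Pre (a ∷ D1) _))
        nvQ : v ∉ Q
        nvQ = proj₁ (Distinct-∉ Q v (z1 ∷ r1) (subst Distinct eQ e-distinct))
        vi : dell π (suc k) ≡ v
        vi = trans (cong (λ t → nth (valleys e) t 0) (sym (+-identityʳ k))) (trans (vn 0 0) (cong (λ l → nth l 0 0) vallD))
        ui : U ≡ z1
        ui = trans (cong (next π) vi) (trans (cong (λ l → nth e (suc l) 0) (trans (cong (indexOf v) eQ) (indexOf-++ Q v (z1 ∷ r1) nvQ)))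
               (trans (cong (λ l → nth l (suc (length Q)) 0) eQ) (nth-++-second Q v z1 r1 0)))
        u∉ : z1 ∉ peaks (v ∷ z1 ∷ r1)
        u∉ p = u∉pins (subst (_∈ peaks e) (sym ui) (subst (λ l → z1 ∈ peaks l) (sym eQ) (peaks-suffix Q v z1 r1 p)))
        byCase : k < j ⊎ k ≡ j → Conclusion
        byCase (inj₁ k<j) = laterRun Pre a D1 v z1 r1 eq v<z1 gD ui u∉
          (λ t d → trans (pn t d) (cong (λ l → nth l t d) peakD))
          (λ t d → trans (vn (suc t) d) (cong (λ l → nth l (suc t) d) vallD))
          (trans ln (cong (λ l → k + length l) peakD)) k<j
        byCase (inj₂ k≡j) = sameRun Pre a D1 v z1 r1 eq decD v<z1 gD ui
          (subst (λ t → dell π (suc t) ≡ v) k≡j vi) (subst (λ t → pin π t ≡ a) k≡j (pin-IsPin k a tp)) u∉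

lemma4 : (n : ℕ) (π : List ℕ) → π ↭ map suc (upTo n) → 1 ≤ n →
  (i q : ℕ) → 1 ≤ i → i ≤ q → q ≤ suc (length (pinnacles π)) →
  dell π i ≤ dell π q →
  next π (dell π i) ∉ pinnacles π →
  next π (dell π i) < pin π (q ∸ 1) →
  ∃[ w₁ ] ∃[ w₂ ] ∃[ w₃ ] ∃[ w₄ ]
    (ValidRev π w₁ w₂ × Balanced π w₁ w₂ ×
     ValidRev (ρ w₁ w₂ π) w₃ w₄ × Balanced (ρ w₁ w₂ π) w₃ w₄ ×
     (dell π q < next π (dell π i) →
        ρ w₃ w₄ (ρ w₁ w₂ π)
          ≡ moveBefore (next π (dell π i)) (cutD π (next π (dell π i)) (q ∸ 1)) π
        × next π (dell π i) ∈ Dset (ρ w₃ w₄ (ρ w₁ w₂ π)) (q ∸ 1)) ×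
     (next π (dell π i) < dell π q →
        ρ w₃ w₄ (ρ w₁ w₂ π) ≡ moveBefore (next π (dell π i)) (dell π q) π
        × dell (ρ w₃ w₄ (ρ w₁ w₂ π)) q ≡ next π (dell π i)))
lemma4 n [] perm 1≤n i q _ _ _ _ _ _ = ⊥-elim (n≮0 (subst (1 ≤_) (sym (PermutationFacts.len (permutationFacts n [] perm))) 1≤n))
lemma4 n (p1 ∷ π') perm 1≤n zero q () _ _ _ _ _
lemma4 n (p1 ∷ π') perm 1≤n (suc k) zero _ () _ _ _ _
lemma4 n (p1 ∷ π') perm 1≤n (suc k) (suc j) _ (s≤s k≤j) (s≤s j≤p) _ u∉pins u<pin =
  Construction.result p1 π' (PermutationFacts.dist PF) bπ k j k≤j j≤p u∉pins u<pin
  where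
  PF : PermutationFacts n (p1 ∷ π')
  PF = permutationFacts n (p1 ∷ π') perm
  bπ : ∀ x → x ∈ (p1 ∷ π') → 0 < x × x ≤ length (p1 ∷ π')
  bπ x p = proj₁ (PermutationFacts.bnd PF x p) , subst (x ≤_) (sym (PermutationFacts.len PF)) (proj₂ (PermutationFacts.bnd PF x p))
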